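{- Let $R$ be a rule set in which pairs of arrows of type $THTH$ nest, such that $\Delta_n=\Delta_n(R)$ is a triangulation of $\partial P_n$ for every $n\ge1$. Then the generating function of saturated faces satisfies $$F(\widehat{\mathcal F},x,0,z)=1+xz\sum_{a,b\ge0}D_{a,b}(x)\,z^{a+b}.$$ More precisely, the contribution to $F(\widehat{\mathcal F},x,0,z)$ of all saturated faces (consisting of forward arrows only) having $a+1$ tails and $b+1$ heads is $D_{a,b}(x)\,xz^{a+b+1}$.
   Context: $P_n$ is the convex hull of $e_j-e_i$ ($i\ne j$) in $\mathbb{R}^{n+1}$. An arrow $(i,j)$, $i\ne j\in\{1,\dots,n+1\}$, has tail $i$ and head $j$; forward if $i<j$, backward if $i>j$; $V_n$ is the set of arrows ($V_0=\emptyset$). For two arrows with four distinct endpoints $p_1<\dots<p_4$, the type is the $T/H$ word of tails/heads at $p_1,\dots,p_4$; the tails and heads can be matched in two ways: for types $THTH,HTHT$ one nests (joins $\{p_1,p_4\},\{p_2,p_3\}$), for $THHT,HTTH$ one crosses (joins $\{p_1,p_3\},\{p_2,p_4\}$), for $TTHH,HHTT$ one nests and one crosses. A rule set $R$ chooses, for each type, which matching is an edge. $\Delta_n(R)$ is the flag complex on $V_n$ whose edges are pairs of distinct arrows with a common tail, with a common head, and pairs with four distinct endpoints forming the matching chosen by $R$; $\Delta_0=\{\emptyset\}$. For $n\ge1$, $\sigma\subseteq V_n$ is saturated if the endpoints of its arrows are exactly $\{1,\dots,n+1\}$; the empty subset of $V_0$ is saturated. $F(\widehat{\mathcal F},x,y,z)=\sum_{n\ge0}\sum_\sigma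 x^{\#\text{forward arrows}}y^{\#\text{backward arrows}}z^n$ over saturated faces $\sigma$ of $\Delta_n$. $D_{a,b}(x)$ is the sum over lattice paths from $(0,0)$ to $(a,b)$ with steps $(0,1),(1,0),(1,1)$ of $x^{\#\text{steps}}$. -}

module Defs where

open import Data.Nat as ℕ using (ℕ; zero; suc; _+_; _<ᵇ_; _≡ᵇ_)
open import Data.Bool using (Bool; true; false; _∧_; _∨_; not; if_then_else_)
open import Data.Fin using (Fin; toℕ)
open import Data.Fin.Properties using () renaming (_≟_ to _≟F_)
open import Data.List using (List; []; _∷_; map; filter; length; allFin; cartesianProduct; _++_)
open import Data.Bool.ListAction using (all; any)
open import Data.List.Membership.Propositional using (_∈_)
open import Data.List.Relation.Unary.All using (All)
open import Data.Product using (_×_; _,_; proj₁; proj₂; Σ; ∃; ∃-syntax)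
open import Data.Product.Properties using (≡-dec)
open import Data.Rational as ℚ using (ℚ; 0ℚ; 1ℚ; ∣_∣) renaming (_+_ to _+q_; _*_ to _*q_; _-_ to _-q_; -_ to -q_)
open import Relation.Nullary using (¬_; does)
open import Relation.Nullary.Decidable.Core using (T?)
open import Relation.Binary.PropositionalEquality using (_≡_)

-- Arrows.  The vertices 1,…,n+1 are represented by Fin (suc n)
-- (vertex k+1 ↦ k, order preserved).  An arrow is a pair (tail , head).

Arrow : ℕ → Set
Arrow n = Fin (suc n) × Fin (suc n)

tail : ∀ {n} → Arrow n → Fin (suc n)
tail = proj₁

head : ∀ {n} → Arrow n → Fin (suc n)
head = proj₂

_=F_ : ∀ {m} → Fin m → Fin m → Bool
i =F j = does (i ≟F j)

_=A_ : ∀ {n} → Arrow n → Arrow n → Bool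
a =A b = does (≡-dec _≟F_ _≟F_ a b)

filterᵇ : ∀ {A : Set} → (A → Bool) → List A → List A
filterᵇ p = filter (λ x → T? (p x))

arrows : (n : ℕ) → List (Arrow n)
arrows n = filterᵇ (λ a → not (tail a =F head a)) (cartesianProduct (allFin (suc n)) (allFin (suc n)))

forwardᵇ : ∀ {n} → Arrow n → Bool
forwardᵇ a = toℕ (tail a) <ᵇ toℕ (head a)

backwardᵇ : ∀ {n} → Arrow n → Bool
backwardᵇ a = toℕ (head a) <ᵇ toℕ (tail a)

data Label : Set where
  T H : Label

data Type : Set where
  THTH HTHT THHT HTTH TTHH HHTT : Type

-- The three ways of splitting p₁<p₂<p₃<p₄ into two pairs:
--   seq   : {p₁,p₂},{p₃,p₄}
--   cross : {p₁,p₃},{p₂,p₄}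
--   nest  : {p₁,p₄},{p₂,p₃}
data Matching : Set where
  seq cross nest : Matching

data Valid : Type → Matching → Set where
  THTH-nest : Valid THTH nest
  THTH-seq  : Valid THTH seq
  HTHT-nest : Valid HTHT nest
  HTHT-seq  : Valid HTHT seq
  THHT-cross : Valid THHT cross
  THHT-seq   : Valid THHT seq
  HTTH-cross : Valid HTTH cross
  HTTH-seq   : Valid HTTH seq
  TTHH-nest  : Valid TTHH nest
  TTHH-cross : Valid TTHH cross
  HHTT-nest  : Valid HHTT nest
  HHTT-cross : Valid HHTT cross

record RuleSet : Set where
  field
    choice : Type → Matching
    valid  : ∀ t → Valid t (choice t)
open RuleSet public

data Maybe′ (A : Set) : Set where
  none : Maybe′ A
  some : A → Maybe′ A

wordType : Label → Label → Label → Label → Maybe′ Type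
wordType T H T H = some THTH
wordType H T H T = some HTHT
wordType T H H T = some THHT
wordType H T T H = some HTTH
wordType T T H H = some TTHH
wordType H H T T = some HHTT
wordType _ _ _ _ = none

module _ {n : ℕ} (a b : Arrow n) where
  private
    t₁ = toℕ (tail a); h₁ = toℕ (head a); t₂ = toℕ (tail b); h₂ = toℕ (head b)
    b2n : Bool → ℕ
    b2n true = 1
    b2n false = 0
    rank : ℕ → ℕ
    rank x = b2n (t₁ <ᵇ x) + b2n (h₁ <ᵇ x) + b2n (t₂ <ᵇ x) + b2n (h₂ <ᵇ x)
    labelAt : ℕ → Label
    labelAt r = if (rank t₁ ≡ᵇ r) ∨ (rank t₂ ≡ᵇ r) then T else H
    -- rank of the endpoint matched with p₁ (the smallest endpoint)
    partnerRank : ℕ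
    partnerRank = if rank t₁ ≡ᵇ 0 then rank h₁ else
                  if rank h₁ ≡ᵇ 0 then rank t₁ else
                  if rank t₂ ≡ᵇ 0 then rank h₂ else rank t₂

  distinct4ᵇ : Bool
  distinct4ᵇ = not (t₁ ≡ᵇ h₁) ∧ not (t₁ ≡ᵇ t₂) ∧ not (t₁ ≡ᵇ h₂)
             ∧ not (h₁ ≡ᵇ t₂) ∧ not (h₁ ≡ᵇ h₂) ∧ not (t₂ ≡ᵇ h₂)

  typeOf : Maybe′ Type
  typeOf = wordType (labelAt 0) (labelAt 1) (labelAt 2) (labelAt 3)

  matchingOf : Matching
  matchingOf with partnerRank
  ... | 1 = seq
  ... | 2 = cross
  ... | _ = nest

_=M_ : Matching → Matching → Bool
seq   =M seq   = true
cross =M cross = true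
nest  =M nest  = true
_     =M _     = false

edgeᵇ : RuleSet → ∀ {n} → Arrow n → Arrow n → Bool
edgeᵇ R a b = not (a =A b) ∧
  ( (tail a =F tail b) ∨ (head a =F head b) ∨
    (distinct4ᵇ a b ∧ chosen (typeOf a b)) )
  where
    chosen : Maybe′ Type → Bool
    chosen none = false
    chosen (some t) = choice R t =M matchingOf a b

-- Subsets of V_n as sublists of the canonical list `arrows n`.

sublists : ∀ {A : Set} → List A → List (List A)
sublists [] = [] ∷ []
sublists (x ∷ xs) = let s = sublists xs in s ++ map (x ∷_) s

-- flag complex: pairwise adjacent
isFaceᵇ : RuleSet → ∀ {n} → List (Arrow n) → Bool
isFaceᵇ R [] = true
isFaceᵇ R (a ∷ σ) = all (edgeᵇ R a) σ ∧ isFaceᵇ R σ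

faces : RuleSet → (n : ℕ) → List (List (Arrow n))
faces R n = filterᵇ (isFaceᵇ R) (sublists (arrows n))

Face : RuleSet → (n : ℕ) → List (Arrow n) → Set
Face R n σ = σ ∈ faces R n

-- saturated faces: endpoints are exactly all vertices (n ≥ 1);
-- for n = 0 the (only) face ∅ is saturated by convention.
saturatedᵇ : (n : ℕ) → List (Arrow n) → Bool
saturatedᵇ zero σ = true
saturatedᵇ (suc n) σ = all (λ v → any (λ a → (tail a =F v) ∨ (head a =F v)) σ) (allFin (suc (suc n)))

#tails : ∀ {n} → List (Arrow n) → ℕ
#tails {n} σ = length (filter (λ v → T? (any (λ a → tail a =F v) σ)) (allFin (suc n)))

#heads : ∀ {n} → List (Arrow n) → ℕ
#heads {n} σ = length (filter (λ v → T? (any (λ a → head a =F v) σ)) (allFin (suc n)))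

#forward : ∀ {n} → List (Arrow n) → ℕ
#forward σ = length (filter (λ a → T? (forwardᵇ a)) σ)

#backward : ∀ {n} → List (Arrow n) → ℕ
#backward σ = length (filter (λ a → T? (backwardᵇ a)) σ)

-- Coefficients of F(𝓕̂, x, 0, z).
-- Setting y = 0 keeps exactly the saturated faces without backward arrows;
-- such a face of Δ_n with k forward arrows contributes x^k z^n.

-- coefficient of x^k z^n in F(𝓕̂, x, 0, z)
coeffF : RuleSet → (n k : ℕ) → ℕ
coeffF R n k = length (filterᵇ (λ σ → saturatedᵇ n σ ∧ (#backward σ ≡ᵇ 0) ∧ (#forward σ ≡ᵇ k)) (faces R n))

-- coefficient of x^k z^n in the contribution of the saturated faces
-- having a+1 tails and b+1 heads
coeffFab : RuleSet → (n a b k : ℕ) → ℕ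
coeffFab R n a b k = length (filterᵇ (λ σ → saturatedᵇ n σ ∧ (#backward σ ≡ᵇ 0) ∧ (#forward σ ≡ᵇ k)
                                        ∧ (#tails σ ≡ᵇ suc a) ∧ (#heads σ ≡ᵇ suc b)) (faces R n))

-- Lattice paths: D_{a,b}(x) = Σ_paths x^{#steps}.

data Step : Set where
  up right diag : Step   -- (0,1), (1,0), (1,1)

stepLists : ℕ → List (List Step)
stepLists zero = [] ∷ []
stepLists (suc k) = let s = stepLists k in map (up ∷_) s ++ map (right ∷_) s ++ map (diag ∷_) s

endX endY : List Step → ℕ
endX [] = 0
endX (up ∷ p) = endX p
endX (right ∷ p) = suc (endX p)
endX (diag ∷ p) = suc (endX p)
endY [] = 0
endY (up ∷ p) = suc (endY p)
endY (right ∷ p) = endY p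
endY (diag ∷ p) = suc (endY p)

-- coefficient of x^k in D_{a,b}(x): number of paths (0,0) → (a,b) with k steps
coeffD : (a b k : ℕ) → ℕ
coeffD a b k = length (filterᵇ (λ p → (endX p ≡ᵇ a) ∧ (endY p ≡ᵇ b)) (stepLists k))

coeffXD : (a b k : ℕ) → ℕ
coeffXD a b zero = 0
coeffXD a b (suc k) = coeffD a b k

Point : ℕ → Set
Point n = Fin (suc n) → ℚ

vtx : ∀ {n} → Arrow n → Point n
vtx a k = if k =F head a then 1ℚ else (if k =F tail a then -q 1ℚ else 0ℚ)

sumℚ : List ℚ → ℚ
sumℚ [] = 0ℚ
sumℚ (q ∷ qs) = q +q sumℚ qs

combo : ∀ {n} → List (Arrow n) → (Arrow n → ℚ) → Point n
combo σ c k = sumℚ (map (λ a → c a *q vtx a k) σ)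

InConv : ∀ {n} → List (Arrow n) → Point n → Set
InConv σ x = ∃[ c ] (All (λ a → 0ℚ ℚ.≤ c a) σ × sumℚ (map c σ) ≡ 1ℚ × (∀ k → combo σ c k ≡ x k))

InAff : ∀ {n} → List (Arrow n) → Point n → Set
InAff σ x = ∃[ c ] (sumℚ (map c σ) ≡ 1ℚ × (∀ k → combo σ c k ≡ x k))

AffIndep : ∀ {n} → List (Arrow n) → Set
AffIndep σ = ∀ c → sumℚ (map c σ) ≡ 0ℚ → (∀ k → combo σ c k ≡ 0ℚ) → All (λ a → c a ≡ 0ℚ) σ

InP : (n : ℕ) → Point n → Set
InP n x = InConv (arrows n) x

dist : ∀ {n} → Point n → Point n → ℚ
dist {n} x y = sumℚ (map (λ k → ∣ x k -q y k ∣) (allFin (suc n)))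

InRelInt : (n : ℕ) → Point n → Set
InRelInt n x = ∃[ ε ] (0ℚ ℚ.< ε × (∀ y → InAff (arrows n) y → dist x y ℚ.< ε → InP n y))

InBoundary : (n : ℕ) → Point n → Set
InBoundary n x = InP n x × ¬ InRelInt n x

_∩_ : ∀ {n} → List (Arrow n) → List (Arrow n) → List (Arrow n)
σ ∩ τ = filterᵇ (λ a → any (a =A_) τ) σ

IsTriangulationOfBoundary : RuleSet → ℕ → Set
IsTriangulationOfBoundary R n =
    (∀ σ → Face R n σ → AffIndep σ)
  × (∀ σ → Face R n σ → ∀ x → InConv σ x → InBoundary n x)
  × (∀ x → InBoundary n x → ∃[ σ ] (Face R n σ × InConv σ x))
  × (∀ σ τ → Face R n σ → Face R n τ → ∀ x → InConv σ x → InConv τ x → InConv (σ ∩ τ) x)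

{-# OPTIONS --safe #-}
module Submission where

open import Defs hiding (T)
open import Data.Nat using (ℕ; zero; suc; _+_; _∸_)
open import Data.Nat.ListAction using (sum)
open import Data.List using (map; upTo)
open import Data.Product using (_×_)
open import Relation.Binary.PropositionalEquality using (_≡_; _≢_)

open import Algebra.Properties.CommutativeSemigroup using (interchange)
open import Data.Bool using (Bool; true; false; T; _∧_; _∨_; not)
open import Data.Bool.ListAction using (any)
open import Data.Bool.Properties using (T-∧; T-∨; T-not-≡)
open import Data.Empty using (⊥; ⊥-elim)
open import Data.Fin as Fin using (Fin; toℕ; fromℕ<)
open import Data.Fin.Properties using (toℕ-injective; toℕ-fromℕ<; toℕ≤pred[n]) renaming (_≟_ to _≟ᶠ_)
open import Data.List using (List; []; _∷_; [_]; filter; length; cartesianProduct; allFin)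
open import Data.List.Extrema.Nat using (argmax; argmax-sel; f[xs]≤f[argmax])
open import Data.List.Membership.Propositional using (_∈_; find; lose)
open import Data.List.Membership.Propositional.Properties
  using (∈-++⁻; ∈-++⁺ˡ; ∈-++⁺ʳ; ∈-map⁺; ∈-map⁻; ∈-filter⁺; ∈-filter⁻; ∈-cartesianProduct⁺; ∈-cartesianProduct⁻;
         ∈-allFin; ∈-upTo⁺; ∈-upTo⁻; ∈-length)
open import Data.List.Membership.Propositional.Properties.WithK using (unique∧set⇒bag)
open import Data.List.Properties
  using (length-map; length-upTo; filter-accept; filter-reject; filter-all; filter-none;
         ∷-injectiveˡ; ∷-injectiveʳ; map-cong; map-cong-local)
open import Data.List.Relation.Binary.BagAndSetEquality using (∼bag⇒↭)
open import Data.List.Relation.Binary.Permutation.Propositional.Properties using (↭-length)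
open import Data.List.Relation.Unary.All as All using (All; []; _∷_)
import Data.List.Relation.Unary.All.Properties as All
open import Data.List.Relation.Unary.AllPairs as AllPairs using (AllPairs; []; _∷_)
import Data.List.Relation.Unary.AllPairs.Properties as AllPairs
open import Data.List.Relation.Unary.Any using (here; there)
open import Data.List.Relation.Unary.Any.Properties using (any⇔)
open import Data.List.Relation.Unary.Unique.Propositional using (Unique)
import Data.List.Relation.Unary.Unique.Propositional.Properties as Unique
open import Data.Nat using (_<_; _≤_; _<ᵇ_; _≡ᵇ_; _<?_; _≤?_; _≟_; z≤n; s≤s)
open import Data.Nat.Properties
open import Data.Product using (_,_; proj₁; proj₂; ∃-syntax; map₁; map₂)
open import Data.Product.Function.NonDependent.Propositional using (_×-⇔_)
open import Data.Product.Properties using (≡-dec; ×-≡,≡→≡; ×-≡,≡←≡)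
open import Data.Product.Relation.Binary.Lex.Strict using (×-Lex)
open import Data.Sum using (_⊎_; inj₁; inj₂; [_,_]′) renaming (map to ⊎-map)
open import Function.Base using (_∘_; id)
open import Function.Bundles using (_⇔_; mk⇔; Equivalence)
open import Function.Properties.Equivalence using () renaming (refl to ⇔-refl; trans to ⇔-trans)
open import Relation.Binary.Definitions using (tri<; tri≈; tri>)
open import Relation.Binary.PropositionalEquality
  using (refl; sym; trans; cong; cong₂; subst; subst₂; module ≡-Reasoning)
open import Relation.Nullary using (¬_; Dec; yes; no; _×-dec_)
open import Relation.Nullary.Decidable using (dec-true; dec-false; T?)
open import Relation.Unary using (Decidable)
open import Data.List.Membership.DecPropositional (≡-dec _≟_ _≟_) using () renaming (_∈?_ to _∈ℕ²?_)

-- Only saturated faces without backward arrows contribute to F(𝓕̂, x, 0, z).  Two forward arrows with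
-- four distinct endpoints form a THTH or a TTHH pair; a THTH pair is not an edge because R lets it nest,
-- and neither is a pair in which the head of one arrow is the tail of the other.  So in such a face all
-- tails precede all heads: the tails are 0 … a and the heads a + 1 … n.  Two arrows with different
-- tails form a TTHH pair, hence their heads are ordered increasingly if R lets TTHH cross, and
-- decreasingly if it lets TTHH nest.  Reading the arrow (t , h) as the grid point (t , h − a − 1), resp.
-- (t , n − h), such faces with a + 1 tails and b + 1 heads are exactly the chains of [0 , a] × [0 , b]
-- meeting every row and every column, i.e. the point sets of the lattice paths from (0 , 0) to (a , b);
-- a path with k steps has k + 1 points.

private variable
  A B : Set

Unique-map⁺ : ∀ {f : A → B} {xs} → (∀ {x x′} → x ∈ xs → x′ ∈ xs → f x ≡ f x′ → x ≡ x′) →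
              Unique xs → Unique (map f xs)
Unique-map⁺ f-inj []           = []
Unique-map⁺ f-inj (x∉xs ∷ xs!) =
  All.map⁺ (All.tabulate λ x′∈xs fx≡fx′ → All.lookup x∉xs x′∈xs (f-inj (here refl) (there x′∈xs) fx≡fx′))
  ∷ Unique-map⁺ (λ x∈xs x′∈xs → f-inj (there x∈xs) (there x′∈xs)) xs!

length-filter-bijection : ∀ {P : A → Set} (P? : Decidable P) {xs : List A} {ys : List B} (f : A → B) →
  Unique xs → Unique ys →
  (∀ {x} → x ∈ xs → P x → f x ∈ ys) →
  (∀ {x x′} → x ∈ xs → x′ ∈ xs → P x → P x′ → f x ≡ f x′ → x ≡ x′) →
  (∀ {y} → y ∈ ys → ∃[ x ] x ∈ xs × P x × f x ≡ y) →
  length (filter P? xs) ≡ length ys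
length-filter-bijection P? {xs} {ys} f xs! ys! into injective onto =
  trans (sym (length-map f (filter P? xs)))
        (↭-length (∼bag⇒↭ (unique∧set⇒bag image! ys! (mk⇔ image⊆ys ys⊆image))))
  where
    image! : Unique (map f (filter P? xs))
    image! = Unique-map⁺ (λ x∈ x′∈ → let (x∈xs , Px) = ∈-filter⁻ P? x∈; (x′∈xs , Px′) = ∈-filter⁻ P? x′∈
                                      in injective x∈xs x′∈xs Px Px′)
                         (Unique.filter⁺ P? xs!)
    image⊆ys : ∀ {y} → y ∈ map f (filter P? xs) → y ∈ ys
    image⊆ys y∈ with ∈-map⁻ f y∈
    ... | x , x∈ , refl = let (x∈xs , Px) = ∈-filter⁻ P? x∈ in into x∈xs Px
    ys⊆image : ∀ {y} → y ∈ ys → y ∈ map f (filter P? xs)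
    ys⊆image y∈ys with onto y∈ys
    ... | x , x∈xs , Px , refl = ∈-map⁺ f (∈-filter⁺ P? x∈xs Px)

length-filter-∷ : ∀ {P : A → Set} (P? : Decidable P) x xs →
                  length (filter P? (x ∷ xs)) ≡ length (filter P? [ x ]) + length (filter P? xs)
length-filter-∷ P? x xs with P? x
... | yes _ = refl
... | no  _ = refl

sum-map-+ : ∀ (f g : B → ℕ) bs → sum (map (λ b → f b + g b) bs) ≡ sum (map f bs) + sum (map g bs)
sum-map-+ f g []       = refl
sum-map-+ f g (b ∷ bs) =
  trans (cong (f b + g b +_) (sum-map-+ f g bs)) (interchange +-commutativeSemigroup (f b) (g b) _ _)

-- Double counting of the pairs (b , x) with q b x.
length-filter-partition : ∀ (p : A → Bool) (q : B → A → Bool) (xs : List A) (bs : List B) →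
  (∀ {x} → x ∈ xs → length (filterᵇ (λ b → q b x) bs) ≡ length (filterᵇ p [ x ])) →
  length (filterᵇ p xs) ≡ sum (map (λ b → length (filterᵇ (q b) xs)) bs)
length-filter-partition p q [] bs _ = sym (sum-zeros bs)
  where
    sum-zeros : ∀ (bs : List B) → sum (map (λ _ → 0) bs) ≡ 0
    sum-zeros []       = refl
    sum-zeros (_ ∷ bs) = sum-zeros bs
length-filter-partition p q (x ∷ xs) bs once = begin
  length (filterᵇ p (x ∷ xs))
    ≡⟨ length-filter-∷ (T? ∘ p) x xs ⟩
  length (filterᵇ p [ x ]) + length (filterᵇ p xs)
    ≡⟨ cong₂ _+_ (sym (once (here refl))) (length-filter-partition p q xs bs (once ∘ there)) ⟩
  length (filterᵇ (λ b → q b x) bs) + sum (map (λ b → length (filterᵇ (q b) xs)) bs)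
    ≡⟨ cong (_+ _) (column bs) ⟩
  sum (map (λ b → length (filterᵇ (q b) [ x ])) bs) + sum (map (λ b → length (filterᵇ (q b) xs)) bs)
    ≡⟨ sym (sum-map-+ _ _ bs) ⟩
  sum (map (λ b → length (filterᵇ (q b) [ x ]) + length (filterᵇ (q b) xs)) bs)
    ≡⟨ cong sum (map-cong (λ b → sym (length-filter-∷ (T? ∘ q b) x xs)) bs) ⟩
  sum (map (λ b → length (filterᵇ (q b) (x ∷ xs))) bs)
    ∎
  where
    open ≡-Reasoning
    column : ∀ bs → length (filterᵇ (λ b → q b x) bs) ≡ sum (map (λ b → length (filterᵇ (q b) [ x ])) bs)
    column []       = refl
    column (b ∷ bs) with q b x
    ... | true  = cong suc (column bs)
    ... | false = column bs

AllPairs-∈ : ∀ {R : A → A → Set} {xs x y} → AllPairs R xs → x ∈ xs → y ∈ xs → x ≡ y ⊎ R x y ⊎ R y x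
AllPairs-∈ (Rx ∷ _)  (here refl) (here refl) = inj₁ refl
AllPairs-∈ (Rx ∷ _)  (here refl) (there y∈)  = inj₂ (inj₁ (All.lookup Rx y∈))
AllPairs-∈ (Rx ∷ _)  (there x∈)  (here refl) = inj₂ (inj₂ (All.lookup Rx x∈))
AllPairs-∈ (_ ∷ Rxs) (there x∈)  (there y∈)  = AllPairs-∈ Rxs x∈ y∈

AllPairs-filter⁺ : ∀ {R S : A → A → Set} {P : A → Set} (P? : Decidable P) {xs} →
                   (∀ {x y} → P x → P y → R x y → S x y) → AllPairs R xs → AllPairs S (filter P? xs)
AllPairs-filter⁺ P? R⇒S []                   = []
AllPairs-filter⁺ P? {x ∷ xs} R⇒S (Rx ∷ Rxs) with P? x
... | yes Px = All.tabulate (λ y∈ → let (y∈xs , Py) = ∈-filter⁻ P? y∈ in R⇒S Px Py (All.lookup Rx y∈xs))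
               ∷ AllPairs-filter⁺ P? R⇒S Rxs
... | no  _  = AllPairs-filter⁺ P? R⇒S Rxs

AllPairs-cartesianProduct⁺ : ∀ {_<₁_ : A → A → Set} {_<₂_ : B → B → Set} {xs ys} →
                             AllPairs _<₁_ xs → AllPairs _<₂_ ys →
                             AllPairs (×-Lex _≡_ _<₁_ _<₂_) (cartesianProduct xs ys)
AllPairs-cartesianProduct⁺ {xs = []}     []           _   = []
AllPairs-cartesianProduct⁺ {_<₁_ = _<₁_} {_<₂_} {x ∷ xs} {ys} (x<xs ∷ xs<) ys< =
  AllPairs.++⁺ (AllPairs.map⁺ (AllPairs.map (λ y<y′ → inj₂ (refl , y<y′)) ys<)) (AllPairs-cartesianProduct⁺ xs< ys<)
               (All.tabulate λ p∈ → All.tabulate (row-before p∈))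
  where
    row-before : ∀ {p q} → p ∈ map (x ,_) ys → q ∈ cartesianProduct xs ys → ×-Lex _≡_ _<₁_ _<₂_ p q
    row-before p∈ q∈ with ∈-map⁻ (x ,_) p∈
    ... | _ , _ , refl = inj₁ (All.lookup x<xs (proj₁ (∈-cartesianProduct⁻ xs ys q∈)))

sublists-⊆ : ∀ (L : List A) {σ x} → σ ∈ sublists L → x ∈ σ → x ∈ L
sublists-⊆ []      (here refl) ()
sublists-⊆ (y ∷ L) σ∈ x∈σ with ∈-++⁻ (sublists L) σ∈
... | inj₁ σ∈L = there (sublists-⊆ L σ∈L x∈σ)
... | inj₂ σ∈yL with ∈-map⁻ (y ∷_) σ∈yL | x∈σ
...   | _ , _   , refl | here refl  = here refl
...   | _ , σ′∈ , refl | there x∈σ′ = there (sublists-⊆ L σ′∈ x∈σ′)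

sublists-AllPairs : ∀ {R : A → A → Set} (L : List A) {σ} → σ ∈ sublists L → AllPairs R L → AllPairs R σ
sublists-AllPairs []      (here refl) [] = []
sublists-AllPairs (y ∷ L) σ∈ (y~L ∷ L~) with ∈-++⁻ (sublists L) σ∈
... | inj₁ σ∈L = sublists-AllPairs L σ∈L L~
... | inj₂ σ∈yL with ∈-map⁻ (y ∷_) σ∈yL
...   | _ , σ′∈ , refl = All.tabulate (All.lookup y~L ∘ sublists-⊆ L σ′∈) ∷ sublists-AllPairs L σ′∈ L~

sublists-Unique : ∀ (L : List A) → Unique L → Unique (sublists L)
sublists-Unique []      []         = [] ∷ []
sublists-Unique (y ∷ L) (y∉L ∷ L!) =
  Unique.++⁺ (sublists-Unique L L!) (Unique.map⁺ ∷-injectiveʳ (sublists-Unique L L!)) disjoint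
  where
    disjoint : ∀ {σ} → ¬ (σ ∈ sublists L × σ ∈ map (y ∷_) (sublists L))
    disjoint (σ∈L , σ∈yL) with ∈-map⁻ (y ∷_) σ∈yL
    ... | _ , _ , refl = All.lookup y∉L (sublists-⊆ L σ∈L (here refl)) refl

filter-∈-sublists : ∀ {P : A → Set} (P? : Decidable P) (L : List A) → filter P? L ∈ sublists L
filter-∈-sublists P? []      = here refl
filter-∈-sublists P? (x ∷ L) with P? x
... | yes _ = ∈-++⁺ʳ (sublists L) (∈-map⁺ (x ∷_) (filter-∈-sublists P? L))
... | no  _ = ∈-++⁺ˡ (filter-∈-sublists P? L)

filter-≡-sublist : ∀ {P : A → Set} (P? : Decidable P) (L : List A) {σ} → Unique L → σ ∈ sublists L →
                   (∀ {x} → x ∈ L → P x ⇔ x ∈ σ) → filter P? L ≡ σ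
filter-≡-sublist P? [] _ (here refl) _ = refl
filter-≡-sublist {P = P} P? (y ∷ L) (y∉L ∷ L!) σ∈ P⇔∈σ with ∈-++⁻ (sublists L) σ∈
... | inj₁ σ∈L =
  trans (filter-reject P? (λ Py → All.lookup y∉L (sublists-⊆ L σ∈L (Equivalence.to (P⇔∈σ (here refl)) Py)) refl))
        (filter-≡-sublist P? L L! σ∈L (P⇔∈σ ∘ there))
... | inj₂ σ∈yL with ∈-map⁻ (y ∷_) σ∈yL
...   | σ′ , σ′∈ , refl =
  trans (filter-accept P? (Equivalence.from (P⇔∈σ (here refl)) (here refl)))
        (cong (y ∷_) (filter-≡-sublist P? L L! σ′∈ P⇔∈σ′))
  where
    drop-y : ∀ {x} → x ∈ L → x ∈ y ∷ σ′ → x ∈ σ′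
    drop-y x∈L (here refl)  = ⊥-elim (All.lookup y∉L x∈L refl)
    drop-y _   (there x∈σ′) = x∈σ′
    P⇔∈σ′ : ∀ {x} → x ∈ L → P x ⇔ x ∈ σ′
    P⇔∈σ′ x∈L = mk⇔ (drop-y x∈L ∘ Equivalence.to (P⇔∈σ (there x∈L))) (Equivalence.from (P⇔∈σ (there x∈L)) ∘ there)

-- Lattice paths

ℕ² : Set
ℕ² = ℕ × ℕ

infix 4 _≼_
_≼_ : ℕ² → ℕ² → Set
q ≼ r = proj₁ q ≤ proj₁ r × proj₂ q ≤ proj₂ r

≼-refl : ∀ {q} → q ≼ q
≼-refl = ≤-refl , ≤-refl

≼-trans : ∀ {q r s} → q ≼ r → r ≼ s → q ≼ s
≼-trans (i≤ , j≤) (i≤′ , j≤′) = ≤-trans i≤ i≤′ , ≤-trans j≤ j≤′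

≼-antisym : ∀ {q r} → q ≼ r → r ≼ q → q ≡ r
≼-antisym (i≤ , j≤) (i≥ , j≥) = cong₂ _,_ (≤-antisym i≤ i≥) (≤-antisym j≤ j≥)

move : Step → ℕ² → ℕ²
move up    (i , j) = i , suc j
move right (i , j) = suc i , j
move diag  (i , j) = suc i , suc j

points : ℕ² → List Step → List ℕ²
points q []      = [ q ]
points q (s ∷ p) = q ∷ points (move s q) p

endpoint : ℕ² → List Step → ℕ²
endpoint q []      = q
endpoint q (s ∷ p) = endpoint (move s q) p

≼-move : ∀ s q → q ≼ move s q
≼-move up    (i , j) = ≤-refl , n≤1+n j
≼-move right (i , j) = n≤1+n i , ≤-refl
≼-move diag  (i , j) = n≤1+n i , n≤1+n j

move-⋠ : ∀ s q → ¬ move s q ≼ q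
move-⋠ up    (i , j) = 1+n≰n ∘ proj₂
move-⋠ right (i , j) = 1+n≰n ∘ proj₁
move-⋠ diag  (i , j) = 1+n≰n ∘ proj₁

move-injective : ∀ {s s′} q → move s q ≡ move s′ q → s ≡ s′
move-injective {up}    {up}    _       _ = refl
move-injective {right} {right} _       _ = refl
move-injective {diag}  {diag}  _       _ = refl
move-injective {up}    {right} (i , j) e = ⊥-elim (<⇒≢ (n<1+n i) (cong proj₁ e))
move-injective {up}    {diag}  (i , j) e = ⊥-elim (<⇒≢ (n<1+n i) (cong proj₁ e))
move-injective {right} {up}    (i , j) e = ⊥-elim (<⇒≢ (n<1+n i) (sym (cong proj₁ e)))
move-injective {right} {diag}  (i , j) e = ⊥-elim (<⇒≢ (n<1+n j) (cong proj₂ e))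
move-injective {diag}  {up}    (i , j) e = ⊥-elim (<⇒≢ (n<1+n i) (sym (cong proj₁ e)))
move-injective {diag}  {right} (i , j) e = ⊥-elim (<⇒≢ (n<1+n j) (sym (cong proj₂ e)))

start∈points : ∀ q p → q ∈ points q p
start∈points q []      = here refl
start∈points q (_ ∷ _) = here refl

length-points : ∀ q p → length (points q p) ≡ suc (length p)
length-points q []      = refl
length-points q (s ∷ p) = cong suc (length-points (move s q) p)

endpoint-origin : ∀ p → endpoint (0 , 0) p ≡ (endX p , endY p)
endpoint-origin = from 0 0
  where
    from : ∀ i j p → endpoint (i , j) p ≡ (i + endX p , j + endY p)
    from i j []          = cong₂ _,_ (sym (+-identityʳ i)) (sym (+-identityʳ j))
    from i j (up ∷ p)    = trans (from i (suc j) p) (cong (i + endX p ,_) (sym (+-suc j (endY p))))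
    from i j (right ∷ p) = trans (from (suc i) j p) (cong (_, j + endY p) (sym (+-suc i (endX p))))
    from i j (diag ∷ p)  =
      trans (from (suc i) (suc j) p) (cong₂ _,_ (sym (+-suc i (endX p))) (sym (+-suc j (endY p))))

points-≽ : ∀ q p {r} → r ∈ points q p → q ≼ r
points-≽ q []      (here refl) = ≼-refl
points-≽ q (s ∷ p) (here refl) = ≼-refl
points-≽ q (s ∷ p) (there r∈)  = ≼-trans (≼-move s q) (points-≽ (move s q) p r∈)

points-≼ : ∀ q p {r} → r ∈ points q p → r ≼ endpoint q p
points-≼ q []      (here refl) = ≼-refl
points-≼ q (s ∷ p) (here refl) = ≼-trans (≼-move s q) (points-≼ (move s q) p (start∈points (move s q) p))
points-≼ q (s ∷ p) (there r∈)  = points-≼ (move s q) p r∈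

points-chain : ∀ q p {r r′} → r ∈ points q p → r′ ∈ points q p → r ≼ r′ ⊎ r′ ≼ r
points-chain q []      (here refl) (here refl) = inj₁ ≼-refl
points-chain q (s ∷ p) (here refl) r′∈         = inj₁ (points-≽ q (s ∷ p) r′∈)
points-chain q (s ∷ p) r∈          (here refl) = inj₂ (points-≽ q (s ∷ p) r∈)
points-chain q (s ∷ p) (there r∈)  (there r′∈) = points-chain (move s q) p r∈ r′∈

later≢start : ∀ {q s p r} → r ∈ points (move s q) p → r ≢ q
later≢start {q} {s} {p} r∈ refl = move-⋠ s q (points-≽ (move s q) p r∈)

points-Unique : ∀ q p → Unique (points q p)
points-Unique q []      = [] ∷ []
points-Unique q (s ∷ p) = All.tabulate (λ r∈ → later≢start r∈ ∘ sym) ∷ points-Unique (move s q) p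

points-cover : (c : ℕ² → ℕ) → (∀ s q → c (move s q) ≤ suc (c q)) →
               ∀ q p {v} → c q ≤ v → v ≤ c (endpoint q p) → ∃[ r ] r ∈ points q p × c r ≡ v
points-cover c c-move q []      q≤v v≤end = q , here refl , ≤-antisym q≤v v≤end
points-cover c c-move q (s ∷ p) {v} q≤v v≤end with c q ≟ v
... | yes cq≡v = q , here refl , cq≡v
... | no  cq≢v with points-cover c c-move (move s q) p (≤-trans (c-move s q) (≤∧≢⇒< q≤v cq≢v)) v≤end
...   | r , r∈ , cr≡v = r , there r∈ , cr≡v

points-cover₁ : ∀ p {v} → v ≤ endX p → ∃[ r ] r ∈ points (0 , 0) p × proj₁ r ≡ v
points-cover₁ p v≤ = points-cover proj₁ step (0 , 0) p z≤n (subst (_ ≤_) (sym (cong proj₁ (endpoint-origin p))) v≤)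
  where
    step : ∀ s q → proj₁ (move s q) ≤ suc (proj₁ q)
    step up    (i , j) = n≤1+n i
    step right (i , j) = ≤-refl
    step diag  (i , j) = ≤-refl

points-cover₂ : ∀ p {v} → v ≤ endY p → ∃[ r ] r ∈ points (0 , 0) p × proj₂ r ≡ v
points-cover₂ p v≤ = points-cover proj₂ step (0 , 0) p z≤n (subst (_ ≤_) (sym (cong proj₂ (endpoint-origin p))) v≤)
  where
    step : ∀ s q → proj₂ (move s q) ≤ suc (proj₂ q)
    step up    (i , j) = ≤-refl
    step right (i , j) = n≤1+n j
    step diag  (i , j) = ≤-refl

points-tail : ∀ {q s p r} → r ∈ points q (s ∷ p) → r ≢ q → r ∈ points (move s q) p
points-tail (here r≡q) r≢q = ⊥-elim (r≢q r≡q)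
points-tail (there r∈) _   = r∈

first-step-≼ : ∀ {q s p s′ p′} → (∀ {r} → r ∈ points q (s ∷ p) → r ∈ points q (s′ ∷ p′)) → move s′ q ≼ move s q
first-step-≼ {q} {s} {p} {s′} {p′} ⊆ =
  points-≽ (move s′ q) p′ (points-tail (⊆ (there (start∈points (move s q) p)))
                                        (later≢start (start∈points (move s q) p)))

points-injective : ∀ q p p′ → (∀ {r} → r ∈ points q p → r ∈ points q p′) →
                   (∀ {r} → r ∈ points q p′ → r ∈ points q p) → p ≡ p′
points-injective q []      []        _ _ = refl
points-injective q []      (s′ ∷ p′) _ ⊇ with ⊇ (there (start∈points (move s′ q) p′))
... | here e = ⊥-elim (later≢start (start∈points (move s′ q) p′) e)
points-injective q (s ∷ p) []        ⊆ _ with ⊆ (there (start∈points (move s q) p))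
... | here e = ⊥-elim (later≢start (start∈points (move s q) p) e)
points-injective q (s ∷ p) (s′ ∷ p′) ⊆ ⊇ with move-injective {s} {s′} q (≼-antisym (first-step-≼ ⊇) (first-step-≼ ⊆))
... | refl = cong (s ∷_) (points-injective (move s q) p p′ (λ r∈ → points-tail (⊆ (there r∈)) (later≢start r∈))
                                                            (λ r∈ → points-tail (⊇ (there r∈)) (later≢start r∈)))

≤-≤-suc : ∀ {m k} → m ≤ k → k ≤ suc m → k ≡ m ⊎ k ≡ suc m
≤-≤-suc m≤k k≤1+m with m≤n⇒m<n∨m≡n m≤k
... | inj₂ m≡k = inj₁ (sym m≡k)
... | inj₁ m<k = inj₂ (≤-antisym k≤1+m m<k)

module ChainToPath (C : ℕ² → Set) (C? : Decidable C) (a b : ℕ)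
  (bounded : ∀ {r} → C r → r ≼ (a , b))
  (chain   : ∀ {r r′} → C r → C r′ → r ≼ r′ ⊎ r′ ≼ r)
  (cover₁  : ∀ {i} → i ≤ a → ∃[ j ] C (i , j))
  (cover₂  : ∀ {j} → j ≤ b → ∃[ i ] C (i , j))
  where

  ≽-of-chain : ∀ {q r} → C q → C r → ¬ r ≼ q → q ≼ r
  ≽-of-chain cq cr r⋠q with chain cq cr
  ... | inj₁ q≼r = q≼r
  ... | inj₂ r≼q = ⊥-elim (r⋠q r≼q)

  Successor : ℕ² → Step → Set
  Successor q s = C (move s q) × (∀ {r} → C r → q ≼ r → r ≡ q ⊎ move s q ≼ r)

  -- The path continues to the first of (i , j + 1), (i + 1 , j), (i + 1 , j + 1) that lies in C.  If none
  -- does, the points of C in column i + 1 and in row j + 1 could not be compared, unless (i , j) = (a , b).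
  successor : ∀ {i j} → C (i , j) → (i , j) ≢ (a , b) → ∃[ s ] Successor (i , j) s
  successor {i} {j} cq q≢ab with C? (i , suc j) | C? (suc i , j) | C? (suc i , suc j)
  ... | yes c↑ | _ | _ = up , c↑ , above
    where
      above : ∀ {r} → C r → (i , j) ≼ r → r ≡ (i , j) ⊎ (i , suc j) ≼ r
      above {k , l} cr (i≤k , j≤l) with chain cr c↑
      ... | inj₂ ↑≼r = inj₂ ↑≼r
      ... | inj₁ (k≤i , l≤1+j) with ≤-antisym k≤i i≤k | ≤-≤-suc j≤l l≤1+j
      ...   | refl | inj₁ refl = inj₁ refl
      ...   | refl | inj₂ refl = inj₂ ≼-refl
  ... | no ¬c↑ | yes c→ | _ = right , c→ , above
    where
      above : ∀ {r} → C r → (i , j) ≼ r → r ≡ (i , j) ⊎ (suc i , j) ≼ r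
      above {k , l} cr (i≤k , j≤l) with chain cr c→
      ... | inj₂ →≼r = inj₂ →≼r
      ... | inj₁ (k≤1+i , l≤j) with ≤-≤-suc i≤k k≤1+i | ≤-antisym l≤j j≤l
      ...   | inj₁ refl | refl = inj₁ refl
      ...   | inj₂ refl | refl = inj₂ ≼-refl
  ... | no ¬c↑ | no ¬c→ | yes c↗ = diag , c↗ , above
    where
      above : ∀ {r} → C r → (i , j) ≼ r → r ≡ (i , j) ⊎ (suc i , suc j) ≼ r
      above {k , l} cr (i≤k , j≤l) with chain cr c↗
      ... | inj₂ ↗≼r = inj₂ ↗≼r
      ... | inj₁ (k≤1+i , l≤1+j) with ≤-≤-suc i≤k k≤1+i | ≤-≤-suc j≤l l≤1+j
      ...   | inj₁ refl | inj₁ refl = inj₁ refl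
      ...   | inj₁ refl | inj₂ refl = ⊥-elim (¬c↑ cr)
      ...   | inj₂ refl | inj₁ refl = ⊥-elim (¬c→ cr)
      ...   | inj₂ refl | inj₂ refl = inj₂ ≼-refl
  ... | no ¬c↑ | no ¬c→ | no ¬c↗ = ⊥-elim (q≢ab (cong₂ _,_ i≡a j≡b))
    where
      j≡b : j ≡ b
      j≡b with m≤n⇒m<n∨m≡n (proj₂ (bounded cq))
      ... | inj₂ j≡b = j≡b
      ... | inj₁ j<b with cover₂ j<b
      ...   | i′ , c′ with ≽-of-chain cq c′ (1+n≰n ∘ proj₂) | <-cmp i′ (suc i)
      ...     | (i≤i′ , _) | tri< i′<1+i _ _ =
        ⊥-elim (¬c↑ (subst (λ k → C (k , suc j)) (≤-antisym (≤-pred i′<1+i) i≤i′) c′))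
      ...     | _ | tri≈ _ refl _ = ⊥-elim (¬c↗ c′)
      ...     | _ | tri> _ _ 1+i<i′ with cover₁ (≤-trans (<⇒≤ 1+i<i′) (proj₁ (bounded c′)))
      ...       | j′ , c″ with ≽-of-chain cq c″ (1+n≰n ∘ proj₁) | ≽-of-chain c″ c′ (<⇒≱ 1+i<i′ ∘ proj₁)
      ...         | (_ , j≤j′) | (_ , j′≤1+j) with ≤-≤-suc j≤j′ j′≤1+j
      ...           | inj₁ refl = ⊥-elim (¬c→ c″)
      ...           | inj₂ refl = ⊥-elim (¬c↗ c″)
      i≡a : i ≡ a
      i≡a with m≤n⇒m<n∨m≡n (proj₁ (bounded cq))
      ... | inj₂ i≡a = i≡a
      ... | inj₁ i<a with cover₁ i<a
      ...   | j′ , c″ with ≽-of-chain cq c″ (1+n≰n ∘ proj₁)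
      ...     | (_ , j≤j′) =
        ⊥-elim (¬c→ (subst (λ l → C (suc i , l))
                           (≤-antisym (≤-trans (proj₂ (bounded c″)) (≤-reflexive (sym j≡b))) j≤j′) c″))

  distance : ℕ² → ℕ
  distance (i , j) = (a ∸ i) + (b ∸ j)

  distance-move : ∀ s q → move s q ≼ (a , b) → distance (move s q) < distance q
  distance-move up    (i , j) (_ , 1+j≤b)     = +-monoʳ-< (a ∸ i) (∸-monoʳ-< (n<1+n j) 1+j≤b)
  distance-move right (i , j) (1+i≤a , _)     = +-monoˡ-< (b ∸ j) (∸-monoʳ-< (n<1+n i) 1+i≤a)
  distance-move diag  (i , j) (1+i≤a , 1+j≤b) = +-mono-< (∸-monoʳ-< (n<1+n i) 1+i≤a) (∸-monoʳ-< (n<1+n j) 1+j≤b)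

  walk : ∀ fuel {q} → distance q ≤ fuel → C q →
         ∃[ p ] endpoint q p ≡ (a , b) × (∀ {r} → r ∈ points q p ⇔ (C r × q ≼ r))
  walk fuel {i , j} _ cq with ≡-dec _≟_ _≟_ (i , j) (a , b)
  ... | yes refl =
    [] , refl , mk⇔ (λ { (here refl) → cq , ≼-refl }) (λ (cr , q≼r) → here (≼-antisym (bounded cr) q≼r))
  ... | no q≢ab with successor cq q≢ab
  walk zero       d cq | no _ | s , cs , _ = ⊥-elim (n≮0 (<-≤-trans (distance-move s _ (bounded cs)) d))
  walk (suc fuel) d cq | no _ | s , cs , above
    with walk fuel (≤-pred (<-≤-trans (distance-move s _ (bounded cs)) d)) cs
  ... | p , end , points⇔ = s ∷ p , end , mk⇔ to from
    where
      to : ∀ {r} → r ∈ points _ (s ∷ p) → C r × _ ≼ r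
      to (here refl) = cq , ≼-refl
      to (there r∈)  = let (cr , s≼r) = Equivalence.to points⇔ r∈ in cr , ≼-trans (≼-move s _) s≼r
      from : ∀ {r} → C r × _ ≼ r → r ∈ points _ (s ∷ p)
      from (cr , q≼r) with above cr q≼r
      ... | inj₁ refl = here refl
      ... | inj₂ s≼r  = there (Equivalence.from points⇔ (cr , s≼r))

  origin : C (0 , 0)
  origin with cover₁ z≤n | cover₂ z≤n
  ... | j , c₀ⱼ | i , cᵢ₀ with chain c₀ⱼ cᵢ₀
  ...   | inj₁ (_ , j≤0) = subst (λ l → C (0 , l)) (n≤0⇒n≡0 j≤0) c₀ⱼ
  ...   | inj₂ (i≤0 , _) = subst (λ k → C (k , 0)) (n≤0⇒n≡0 i≤0) cᵢ₀

  chain-path : ∃[ p ] endpoint (0 , 0) p ≡ (a , b) × (∀ {r} → r ∈ points (0 , 0) p ⇔ C r)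
  chain-path with walk (a + b) ≤-refl origin
  ... | p , end , points⇔ =
    p , end , mk⇔ (proj₁ ∘ Equivalence.to points⇔) (λ cr → Equivalence.from points⇔ (cr , z≤n , z≤n))

stepLists-length : ∀ k {p} → p ∈ stepLists k → length p ≡ k
stepLists-length zero    (here refl) = refl
stepLists-length (suc k) {p} p∈ with ∈-++⁻ (map (up ∷_) (stepLists k)) p∈
... | inj₁ p∈↑ with ∈-map⁻ (up ∷_) p∈↑
...   | p′ , p′∈ , refl = cong suc (stepLists-length k p′∈)
stepLists-length (suc k) {p} p∈ | inj₂ p∈→↗ with ∈-++⁻ (map (right ∷_) (stepLists k)) p∈→↗
... | inj₁ p∈→ with ∈-map⁻ (right ∷_) p∈→
...   | p′ , p′∈ , refl = cong suc (stepLists-length k p′∈)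
stepLists-length (suc k) {p} p∈ | inj₂ _ | inj₂ p∈↗ with ∈-map⁻ (diag ∷_) p∈↗
...   | p′ , p′∈ , refl = cong suc (stepLists-length k p′∈)

∈-stepLists : ∀ p → p ∈ stepLists (length p)
∈-stepLists []          = here refl
∈-stepLists (up ∷ p)    = ∈-++⁺ˡ (∈-map⁺ (up ∷_) (∈-stepLists p))
∈-stepLists (right ∷ p) =
  ∈-++⁺ʳ (map (up ∷_) (stepLists (length p))) (∈-++⁺ˡ (∈-map⁺ (right ∷_) (∈-stepLists p)))
∈-stepLists (diag ∷ p)  =
  ∈-++⁺ʳ (map (up ∷_) (stepLists (length p)))
         (∈-++⁺ʳ (map (right ∷_) (stepLists (length p))) (∈-map⁺ (diag ∷_) (∈-stepLists p)))

stepLists-Unique : ∀ k → Unique (stepLists k)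
stepLists-Unique zero    = [] ∷ []
stepLists-Unique (suc k) =
  Unique.++⁺ (prefixed up) (Unique.++⁺ (prefixed right) (prefixed diag) (disjoint (λ ())))
             (λ (p∈↑ , p∈→↗) → [ disjoint (λ ()) ∘ (p∈↑ ,_) , disjoint (λ ()) ∘ (p∈↑ ,_) ]′ (∈-++⁻ _ p∈→↗))
  where
    prefixed : ∀ s → Unique (map (s ∷_) (stepLists k))
    prefixed s = Unique.map⁺ ∷-injectiveʳ (stepLists-Unique k)
    disjoint : ∀ {s s′ p} → s ≢ s′ → ¬ (p ∈ map (s ∷_) (stepLists k) × p ∈ map (s′ ∷_) (stepLists k))
    disjoint s≢s′ (p∈ , p∈′) with ∈-map⁻ _ p∈ | ∈-map⁻ _ p∈′
    ... | _ , _ , refl | _ , _ , e = s≢s′ (∷-injectiveˡ e)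

pt : ∀ {n} → Arrow n → ℕ²
pt x = toℕ (tail x) , toℕ (head x)

pt-injective : ∀ {n} {x y : Arrow n} → pt x ≡ pt y → x ≡ y
pt-injective e = cong₂ _,_ (toℕ-injective (cong proj₁ e)) (toℕ-injective (cong proj₂ e))

infix 4 _<ₗ_
_<ₗ_ : ℕ² → ℕ² → Set
_<ₗ_ = ×-Lex _≡_ _<_ _<_

<ₗ-asym : ∀ {q r} → q <ₗ r → ¬ r <ₗ q
<ₗ-asym (inj₁ i<k)       (inj₁ k<i)       = <-asym i<k k<i
<ₗ-asym (inj₁ i<k)       (inj₂ (k≡i , _)) = <-irrefl (sym k≡i) i<k
<ₗ-asym (inj₂ (i≡k , _)) (inj₁ k<i)       = <-irrefl (sym i≡k) k<i
<ₗ-asym (inj₂ (_ , j<l)) (inj₂ (_ , l<j)) = <-asym j<l l<j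

module _ {n : ℕ} where

  private
    non-loop? : (x : Arrow n) → Dec (T (not (tail x =F head x)))
    non-loop? x = T? (not (tail x =F head x))

  arrows-sorted : AllPairs (λ x y → pt x <ₗ pt y) (arrows n)
  arrows-sorted = AllPairs.filter⁺ non-loop? (AllPairs.map toℕ-Lex (AllPairs-cartesianProduct⁺ allFin< allFin<))
    where
      allFin< : AllPairs (λ i j → toℕ i < toℕ j) (allFin (suc n))
      allFin< = AllPairs.tabulate⁺-< id
      toℕ-Lex : ∀ {x y : Arrow n} → ×-Lex _≡_ (λ i j → toℕ i < toℕ j) (λ i j → toℕ i < toℕ j) x y → pt x <ₗ pt y
      toℕ-Lex = ⊎-map id (map₁ (cong toℕ))

  arrows-Unique : Unique (arrows n)
  arrows-Unique =
    Unique.filter⁺ non-loop? (Unique.cartesianProduct⁺ (Unique.allFin⁺ (suc n)) (Unique.allFin⁺ (suc n)))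

  ∈-arrows : ∀ {x : Arrow n} → tail x ≢ head x → x ∈ arrows n
  ∈-arrows {x} t≢h = ∈-filter⁺ non-loop? (∈-cartesianProduct⁺ (∈-allFin (tail x)) (∈-allFin (head x)))
                                         (Equivalence.from T-not-≡ (dec-false (tail x ≟ᶠ head x) t≢h))

  arrows-loopless : ∀ {x : Arrow n} → x ∈ arrows n → tail x ≢ head x
  arrows-loopless {x} x∈ t≡h
    with trans (sym (dec-true (tail x ≟ᶠ head x) t≡h))
               (Equivalence.to T-not-≡ (proj₂ (∈-filter⁻ non-loop? {xs = cartesianProduct (allFin _) (allFin _)} x∈)))
  ... | ()

isFaceᵇ⇔ : ∀ R {n} (σ : List (Arrow n)) → T (isFaceᵇ R σ) ⇔ AllPairs (λ x y → T (edgeᵇ R x y)) σ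
isFaceᵇ⇔ R []      = mk⇔ (λ _ → []) _
isFaceᵇ⇔ R (x ∷ σ) =
  mk⇔ (λ face → let (x~σ , σ-face) = Equivalence.to T-∧ face
                 in All.all⁺ _ σ x~σ ∷ Equivalence.to (isFaceᵇ⇔ R σ) σ-face)
      (λ { (x~σ ∷ σ~) → Equivalence.from T-∧ (All.all⁻ _ x~σ , Equivalence.from (isFaceᵇ⇔ R σ) σ~) })

T-≡ᵇ : ∀ {m n} → T (m ≡ᵇ n) ⇔ m ≡ n
T-≡ᵇ = mk⇔ (≡ᵇ⇒≡ _ _) (≡⇒≡ᵇ _ _)

=F⇔ : ∀ {k} {i j : Fin k} → T (i =F j) ⇔ i ≡ j
=F⇔ {i = i} {j} with i ≟ᶠ j
... | yes i≡j = mk⇔ (λ _ → i≡j) _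
... | no  i≢j = mk⇔ (λ ()) (⊥-elim ∘ i≢j)

T-any⇔ : ∀ (p : A → Bool) {xs} → T (any p xs) ⇔ (∃[ x ] x ∈ xs × T (p x))
T-any⇔ p = mk⇔ (find ∘ Equivalence.from any⇔) (Equivalence.to any⇔ ∘ λ (_ , x∈ , px) → lose x∈ px)

vertex : ∀ {n k} → k ≤ n → Fin (suc n)
vertex k≤n = fromℕ< (s≤s k≤n)

toℕ-vertex : ∀ {n k} (k≤n : k ≤ n) → toℕ (vertex k≤n) ≡ k
toℕ-vertex k≤n = toℕ-fromℕ< (s≤s k≤n)

length-filter-allFin : ∀ {n} {P : Fin (suc n) → Set} (P? : Decidable P) (g : ℕ → ℕ) k →
  (∀ {w} → P w → g (toℕ w) < k) →
  (∀ {w w′} → P w → P w′ → g (toℕ w) ≡ g (toℕ w′) → w ≡ w′) →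
  (∀ {i} → i < k → ∃[ w ] P w × g (toℕ w) ≡ i) →
  length (filter P? (allFin (suc n))) ≡ k
length-filter-allFin {n} P? g k into injective onto =
  trans (length-filter-bijection P? (g ∘ toℕ) (Unique.allFin⁺ (suc n)) (Unique.upTo⁺ k) (λ _ → ∈-upTo⁺ ∘ into)
                                 (λ _ _ → injective)
                                 (λ i∈ → let (w , Pw , gw≡i) = onto (∈-upTo⁻ i∈) in w , ∈-allFin w , Pw , gw≡i))
        (length-upTo k)

module _ {n : ℕ} (σ : List (Arrow n)) where

  Tail Head : Fin (suc n) → Set
  Tail w = ∃[ x ] x ∈ σ × tail x ≡ w
  Head w = ∃[ x ] x ∈ σ × head x ≡ w

  Covered : Fin (suc n) → Set
  Covered w = ∃[ x ] x ∈ σ × (tail x ≡ w ⊎ head x ≡ w)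

  private
    T-any-=F⇔ : ∀ (end : Arrow n → Fin (suc n)) {w} → T (any (λ x → end x =F w) σ) ⇔ (∃[ x ] x ∈ σ × end x ≡ w)
    T-any-=F⇔ end = mk⇔ (map₂ (map₂ (Equivalence.to =F⇔)) ∘ Equivalence.to (T-any⇔ _))
                        (Equivalence.from (T-any⇔ _) ∘ map₂ (map₂ (Equivalence.from =F⇔)))

  #tails-initial : ∀ {a} → a ≤ n → (∀ w → Tail w ⇔ toℕ w ≤ a) → #tails σ ≡ suc a
  #tails-initial {a} a≤n tail⇔ =
    length-filter-allFin (λ w → T? (any (λ x → tail x =F w) σ)) id (suc a)
      (s≤s ∘ Equivalence.to tail⇔′) (λ _ _ → toℕ-injective) onto
    where
      tail⇔′ : ∀ {w} → T (any (λ x → tail x =F w) σ) ⇔ toℕ w ≤ a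
      tail⇔′ {w} = ⇔-trans (T-any-=F⇔ tail) (tail⇔ w)
      onto : ∀ {i} → i < suc a → ∃[ w ] T (any (λ x → tail x =F w) σ) × toℕ w ≡ i
      onto (s≤s i≤a) = let i≤n = ≤-trans i≤a a≤n in
        vertex i≤n , Equivalence.from tail⇔′ (subst (_≤ a) (sym (toℕ-vertex i≤n)) i≤a) , toℕ-vertex i≤n

  #heads-final : ∀ {a b} → suc (a + b) ≡ n → (∀ w → Head w ⇔ a < toℕ w) → #heads σ ≡ suc b
  #heads-final {a} {b} refl head⇔ =
    length-filter-allFin (λ w → T? (any (λ x → head x =F w) σ)) (_∸ suc a) (suc b)
      (λ {w} _ → s≤s (m≤n+o⇒m∸n≤o (toℕ w) (suc a) (toℕ≤pred[n] w))) injective onto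
    where
      head⇔′ : ∀ {w} → T (any (λ x → head x =F w) σ) ⇔ a < toℕ w
      head⇔′ {w} = ⇔-trans (T-any-=F⇔ head) (head⇔ w)
      injective : ∀ {w w′} → T (any (λ x → head x =F w) σ) → T (any (λ x → head x =F w′) σ) →
                  toℕ w ∸ suc a ≡ toℕ w′ ∸ suc a → w ≡ w′
      injective Hw Hw′ = toℕ-injective ∘ ∸-cancelʳ-≡ (Equivalence.to head⇔′ Hw) (Equivalence.to head⇔′ Hw′)
      onto : ∀ {i} → i < suc b → ∃[ w ] T (any (λ x → head x =F w) σ) × toℕ w ∸ suc a ≡ i
      onto {i} (s≤s i≤b) = let h≤n = s≤s (+-monoʳ-≤ a i≤b) in
        vertex h≤n , Equivalence.from head⇔′ (subst (a <_) (sym (toℕ-vertex h≤n)) (s≤s (m≤m+n a i))) ,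
        trans (cong (_∸ suc a) (toℕ-vertex h≤n)) (m+n∸m≡n (suc a) i)

saturated⇔ : ∀ {m} (σ : List (Arrow (suc m))) → T (saturatedᵇ (suc m) σ) ⇔ (∀ w → Covered σ w)
saturated⇔ {m} σ = mk⇔ (λ sat w → covered (All.lookup (All.all⁺ covers (allFin (suc (suc m))) sat) (∈-allFin w)))
                       (λ cov → All.all⁻ covers {allFin (suc (suc m))} (All.tabulate (λ {w} _ → uncovered (cov w))))
  where
    covers : Fin (suc (suc m)) → Bool
    covers w = any (λ x → (tail x =F w) ∨ (head x =F w)) σ
    endpoint⇔ : ∀ {w} x → T ((tail x =F w) ∨ (head x =F w)) ⇔ (tail x ≡ w ⊎ head x ≡ w)
    endpoint⇔ x = mk⇔ (⊎-map (Equivalence.to =F⇔) (Equivalence.to =F⇔) ∘ Equivalence.to T-∨)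
                      (Equivalence.from T-∨ ∘ ⊎-map (Equivalence.from =F⇔) (Equivalence.from =F⇔))
    covered : ∀ {w} → T (covers w) → Covered σ w
    covered c = let (x , x∈ , e) = Equivalence.to (T-any⇔ _) c in x , x∈ , Equivalence.to (endpoint⇔ x) e
    uncovered : ∀ {w} → Covered σ w → T (covers w)
    uncovered (x , x∈ , e) = Equivalence.from (T-any⇔ _) (x , x∈ , Equivalence.from (endpoint⇔ x) e)

-- Edges between forward arrows

<ᵇ-true : ∀ {m n} → m < n → (m <ᵇ n) ≡ true
<ᵇ-true {m} {n} = dec-true (m <? n)

<ᵇ-false : ∀ {m n} → n ≤ m → (m <ᵇ n) ≡ false
<ᵇ-false {m} {n} n≤m = dec-false (m <? n) (λ m<n → <⇒≱ m<n n≤m)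

<ᵇ-irrefl : ∀ m → (m <ᵇ m) ≡ false
<ᵇ-irrefl m = <ᵇ-false {m} ≤-refl

≡ᵇ-false : ∀ {m n} → m ≢ n → (m ≡ᵇ n) ≡ false
≡ᵇ-false {m} {n} = dec-false (m ≟ n)

HasType : ∀ {n} → Arrow n → Arrow n → Type → Matching → Set
HasType x y τ μ = distinct4ᵇ x y ≡ true × typeOf x y ≡ some τ × matchingOf x y ≡ μ

-- distinct4ᵇ, typeOf and matchingOf only compare the four endpoints, so rewriting the comparisons
-- that occur evaluates them.
module _ {n : ℕ} {t₁ h₁ t₂ h₂ : Fin (suc n)} where

  type-THTH-seq : toℕ t₁ < toℕ h₁ → toℕ h₁ < toℕ t₂ → toℕ t₂ < toℕ h₂ → HasType (t₁ , h₁) (t₂ , h₂) THTH seq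
  type-THTH-seq p q r
    rewrite <ᵇ-irrefl (toℕ t₁) | <ᵇ-irrefl (toℕ h₁) | <ᵇ-irrefl (toℕ t₂) | <ᵇ-irrefl (toℕ h₂)
          | <ᵇ-true p | <ᵇ-true q | <ᵇ-true r | <ᵇ-true (<-trans p q)
          | <ᵇ-false (<⇒≤ p) | <ᵇ-false (<⇒≤ q) | <ᵇ-false (<⇒≤ r)
          | <ᵇ-false (<⇒≤ (<-trans p q)) | <ᵇ-false (<⇒≤ (<-trans q r)) | <ᵇ-false (<⇒≤ (<-trans p (<-trans q r)))
          | ≡ᵇ-false (<⇒≢ p) | ≡ᵇ-false (<⇒≢ (<-trans p q)) | ≡ᵇ-false (<⇒≢ (<-trans p (<-trans q r)))
          | ≡ᵇ-false (<⇒≢ q) | ≡ᵇ-false (<⇒≢ (<-trans q r)) | ≡ᵇ-false (<⇒≢ r)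
    = refl , refl , refl

  type-TTHH-cross : toℕ t₁ < toℕ t₂ → toℕ t₂ < toℕ h₁ → toℕ h₁ < toℕ h₂ → HasType (t₁ , h₁) (t₂ , h₂) TTHH cross
  type-TTHH-cross p q r
    rewrite <ᵇ-irrefl (toℕ t₁) | <ᵇ-irrefl (toℕ h₁) | <ᵇ-irrefl (toℕ t₂) | <ᵇ-irrefl (toℕ h₂)
          | <ᵇ-true p | <ᵇ-true q | <ᵇ-true (<-trans p q)
          | <ᵇ-false (<⇒≤ p) | <ᵇ-false (<⇒≤ q) | <ᵇ-false (<⇒≤ r)
          | <ᵇ-false (<⇒≤ (<-trans p q)) | <ᵇ-false (<⇒≤ (<-trans q r)) | <ᵇ-false (<⇒≤ (<-trans p (<-trans q r)))
          | ≡ᵇ-false (<⇒≢ (<-trans p q)) | ≡ᵇ-false (<⇒≢ p) | ≡ᵇ-false (<⇒≢ (<-trans p (<-trans q r)))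
          | ≡ᵇ-false (>⇒≢ q) | ≡ᵇ-false (<⇒≢ r) | ≡ᵇ-false (<⇒≢ (<-trans q r))
    = refl , refl , refl

  type-TTHH-nest : toℕ t₁ < toℕ t₂ → toℕ t₂ < toℕ h₂ → toℕ h₂ < toℕ h₁ → HasType (t₁ , h₁) (t₂ , h₂) TTHH nest
  type-TTHH-nest p q r
    rewrite <ᵇ-irrefl (toℕ t₁) | <ᵇ-irrefl (toℕ h₁) | <ᵇ-irrefl (toℕ t₂) | <ᵇ-irrefl (toℕ h₂)
          | <ᵇ-true p | <ᵇ-true r | <ᵇ-true (<-trans q r) | <ᵇ-true (<-trans p (<-trans q r))
          | <ᵇ-false (<⇒≤ p) | <ᵇ-false (<⇒≤ q)
          | <ᵇ-false (<⇒≤ (<-trans p q)) | <ᵇ-false (<⇒≤ (<-trans q r)) | <ᵇ-false (<⇒≤ (<-trans p (<-trans q r)))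
          | ≡ᵇ-false (<⇒≢ (<-trans p (<-trans q r))) | ≡ᵇ-false (<⇒≢ p) | ≡ᵇ-false (<⇒≢ (<-trans p q))
          | ≡ᵇ-false (>⇒≢ (<-trans q r)) | ≡ᵇ-false (>⇒≢ r) | ≡ᵇ-false (<⇒≢ q)
    = refl , refl , refl

module _ (R : RuleSet) {n : ℕ} {t₁ h₁ t₂ h₂ : Fin (suc n)} where

  edge-common-tail : t₁ ≡ t₂ → h₁ ≢ h₂ → T (edgeᵇ R (t₁ , h₁) (t₂ , h₂))
  edge-common-tail refl h₁≢h₂
    rewrite dec-false (≡-dec _≟ᶠ_ _≟ᶠ_ (t₁ , h₁) (t₁ , h₂)) (h₁≢h₂ ∘ cong proj₂)
          | dec-true (t₁ ≟ᶠ t₁) refl = _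

  edge-common-head : t₁ ≢ t₂ → h₁ ≡ h₂ → T (edgeᵇ R (t₁ , h₁) (t₂ , h₂))
  edge-common-head t₁≢t₂ refl
    rewrite dec-false (≡-dec _≟ᶠ_ _≟ᶠ_ (t₁ , h₁) (t₂ , h₁)) (t₁≢t₂ ∘ cong proj₁)
          | dec-false (t₁ ≟ᶠ t₂) t₁≢t₂
          | dec-true (h₁ ≟ᶠ h₁) refl = _

  edge-through-vertex : toℕ t₁ < toℕ h₁ → h₁ ≡ t₂ → toℕ t₂ < toℕ h₂ → ¬ T (edgeᵇ R (t₁ , h₁) (t₂ , h₂))
  edge-through-vertex p refl r
    rewrite dec-false (≡-dec _≟ᶠ_ _≟ᶠ_ (t₁ , h₁) (h₁ , h₂)) (<⇒≢ p ∘ cong (toℕ ∘ proj₁))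
          | dec-false (t₁ ≟ᶠ h₁) (<⇒≢ p ∘ cong toℕ)
          | dec-false (h₁ ≟ᶠ h₂) (<⇒≢ r ∘ cong toℕ)
          | ≡ᵇ-false (<⇒≢ p) | ≡ᵇ-false (<⇒≢ (<-trans p r)) | dec-true (toℕ h₁ ≟ toℕ h₁) refl = λ ()

  edge-of-type : ∀ {τ μ} → t₁ ≢ t₂ → h₁ ≢ h₂ → HasType (t₁ , h₁) (t₂ , h₂) τ μ →
                 edgeᵇ R (t₁ , h₁) (t₂ , h₂) ≡ (choice R τ =M μ)
  edge-of-type t₁≢t₂ h₁≢h₂ (distinct , type , matching)
    rewrite dec-false (≡-dec _≟ᶠ_ _≟ᶠ_ (t₁ , h₁) (t₂ , h₂)) (t₁≢t₂ ∘ cong proj₁)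
          | dec-false (t₁ ≟ᶠ t₂) t₁≢t₂
          | dec-false (h₁ ≟ᶠ h₂) h₁≢h₂
          | type | matching = cong (_∧ _) distinct

-- The order of the heads of two adjacent forward arrows with increasing tails: crossing TTHH pairs
-- have increasing heads, nesting ones decreasing heads.
HeadOrder : ∀ {μ} → Valid TTHH μ → ℕ → ℕ → Set
HeadOrder TTHH-cross h h′ = h ≤ h′
HeadOrder TTHH-nest  h h′ = h′ ≤ h

HeadOrder-reflexive : ∀ {μ} (v : Valid TTHH μ) {h h′} → h ≡ h′ → HeadOrder v h h′
HeadOrder-reflexive TTHH-cross h≡h′ = ≤-reflexive h≡h′
HeadOrder-reflexive TTHH-nest  h≡h′ = ≤-reflexive (sym h≡h′)

HeadOrder-< : ∀ {μ} (v : Valid TTHH μ) {h h′} → h < h′ → T (μ =M cross) ⇔ HeadOrder v h h′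
HeadOrder-< TTHH-cross h<h′ = mk⇔ (λ _ → <⇒≤ h<h′) _
HeadOrder-< TTHH-nest  h<h′ = mk⇔ ⊥-elim (<⇒≱ h<h′)

HeadOrder-> : ∀ {μ} (v : Valid TTHH μ) {h h′} → h′ < h → T (μ =M nest) ⇔ HeadOrder v h h′
HeadOrder-> TTHH-cross h′<h = mk⇔ ⊥-elim (<⇒≱ h′<h)
HeadOrder-> TTHH-nest  h′<h = mk⇔ (λ _ → <⇒≤ h′<h) _

⇔-×ˡ : ∀ {A B C : Set} → A → B ⇔ C → B ⇔ (A × C)
⇔-×ˡ a B⇔C = mk⇔ (λ b → a , Equivalence.to B⇔C b) (Equivalence.from B⇔C ∘ proj₂)

module _ (R : RuleSet) (thth : choice R THTH ≡ nest) {n : ℕ} {t₁ h₁ t₂ h₂ : Fin (suc n)} where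

  edge-forward : toℕ t₁ < toℕ h₁ → toℕ t₂ < toℕ h₂ → toℕ t₁ < toℕ t₂ →
                 T (edgeᵇ R (t₁ , h₁) (t₂ , h₂)) ⇔ (toℕ t₂ < toℕ h₁ × HeadOrder (valid R TTHH) (toℕ h₁) (toℕ h₂))
  edge-forward f₁ f₂ t₁<t₂ with <-cmp (toℕ t₂) (toℕ h₁)
  ... | tri> _ _ h₁<t₂ = mk⇔ (⊥-elim ∘ separated) (⊥-elim ∘ <-asym h₁<t₂ ∘ proj₁)
    where
      separated : ¬ T (edgeᵇ R (t₁ , h₁) (t₂ , h₂))
      separated rewrite edge-of-type R (<⇒≢ t₁<t₂ ∘ cong toℕ) (<⇒≢ (<-trans h₁<t₂ f₂) ∘ cong toℕ)
                                       (type-THTH-seq f₁ h₁<t₂ f₂)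
                      | thth = λ ()
  ... | tri≈ _ t₂≡h₁ _ = mk⇔ (⊥-elim ∘ edge-through-vertex R f₁ (toℕ-injective (sym t₂≡h₁)) f₂)
                             (⊥-elim ∘ <-irrefl t₂≡h₁ ∘ proj₁)
  ... | tri< t₂<h₁ _ _ with <-cmp (toℕ h₁) (toℕ h₂)
  ...   | tri≈ _ h₁≡h₂ _ = mk⇔ (λ _ → t₂<h₁ , HeadOrder-reflexive (valid R TTHH) h₁≡h₂)
                               (λ _ → edge-common-head R (<⇒≢ t₁<t₂ ∘ cong toℕ) (toℕ-injective h₁≡h₂))
  ...   | tri< h₁<h₂ _ _
    rewrite edge-of-type R (<⇒≢ t₁<t₂ ∘ cong toℕ) (<⇒≢ h₁<h₂ ∘ cong toℕ) (type-TTHH-cross t₁<t₂ t₂<h₁ h₁<h₂)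
    = ⇔-×ˡ t₂<h₁ (HeadOrder-< (valid R TTHH) h₁<h₂)
  ...   | tri> _ _ h₂<h₁
    rewrite edge-of-type R (<⇒≢ t₁<t₂ ∘ cong toℕ) (>⇒≢ h₂<h₁ ∘ cong toℕ) (type-TTHH-nest t₁<t₂ f₂ h₂<h₁)
    = ⇔-×ˡ t₂<h₁ (HeadOrder-> (valid R TTHH) h₂<h₁)

reflect : ∀ {μ} → Valid TTHH μ → ℕ → ℕ → ℕ
reflect TTHH-cross b j = j
reflect TTHH-nest  b j = b ∸ j

reflect-≤ : ∀ {μ} (v : Valid TTHH μ) {b j} → j ≤ b → reflect v b j ≤ b
reflect-≤ TTHH-cross         j≤b = j≤b
reflect-≤ TTHH-nest  {b} {j} _   = m∸n≤m b j

reflect-involutive : ∀ {μ} (v : Valid TTHH μ) {b j} → j ≤ b → reflect v b (reflect v b j) ≡ j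
reflect-involutive TTHH-cross _   = refl
reflect-involutive TTHH-nest  j≤b = m∸[m∸n]≡n j≤b

HeadOrder-reflect : ∀ {μ} (v : Valid TTHH μ) a {b j j′} → j ≤ b → j′ ≤ b →
                    HeadOrder v (suc (a + reflect v b j)) (suc (a + reflect v b j′)) ⇔ j ≤ j′
HeadOrder-reflect TTHH-cross a     _   _ = mk⇔ (+-cancelˡ-≤ a _ _ ∘ ≤-pred) (s≤s ∘ +-monoʳ-≤ a)
HeadOrder-reflect TTHH-nest  a {b} j≤b _ =
  mk⇔ (∸-cancelʳ-≤ j≤b ∘ +-cancelˡ-≤ a _ _ ∘ ≤-pred) (s≤s ∘ +-monoʳ-≤ a ∘ ∸-monoʳ-≤ b)

-- The grid point (i , j) of [0 , a] × [0 , b] stands for the arrow from i to a + 1 + j if TTHH pairs cross,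
-- and to a + 1 + b − j if they nest, so that faces become chains for the product order _≼_.
module Grid {μ} (v : Valid TTHH μ) (a b : ℕ) where

  corner : ℕ² → ℕ²
  corner (i , j) = i , suc (a + reflect v b j)

  uncorner : ℕ² → ℕ²
  uncorner (t , h) = t , reflect v b (h ∸ suc a)

  private
    below-window : ∀ {h} → h ≤ suc (a + b) → h ∸ suc a ≤ b
    below-window {h} h≤ = m≤n+o⇒m∸n≤o h (suc a) h≤

  corner-window : ∀ {r} → r ≼ (a , b) → proj₁ (corner r) ≤ a × a < proj₂ (corner r) × proj₂ (corner r) ≤ suc (a + b)
  corner-window {i , j} (i≤a , j≤b) = i≤a , s≤s (m≤m+n a _) , s≤s (+-monoʳ-≤ a (reflect-≤ v j≤b))

  uncorner-corner : ∀ {r} → r ≼ (a , b) → uncorner (corner r) ≡ r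
  uncorner-corner {i , j} (_ , j≤b) =
    cong (i ,_) (trans (cong (reflect v b) (m+n∸m≡n (suc a) (reflect v b j))) (reflect-involutive v j≤b))

  corner-injective : ∀ {r r′} → r ≼ (a , b) → r′ ≼ (a , b) → corner r ≡ corner r′ → r ≡ r′
  corner-injective r≼ r′≼ e = trans (sym (uncorner-corner r≼)) (trans (cong uncorner e) (uncorner-corner r′≼))

  corner-uncorner : ∀ {t h} → a < h → h ≤ suc (a + b) → corner (uncorner (t , h)) ≡ (t , h)
  corner-uncorner {t} {h} a<h h≤ =
    cong (t ,_) (trans (cong (λ k → suc (a + k)) (reflect-involutive v (below-window h≤))) (m+[n∸m]≡n a<h))

  uncorner-≼ : ∀ {t h} → t ≤ a → h ≤ suc (a + b) → uncorner (t , h) ≼ (a , b)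
  uncorner-≼ t≤a h≤ = t≤a , reflect-≤ v (below-window h≤)

  corner-arrow : ∀ {m r} → a + b ≡ m → r ≼ (a , b) → ∃[ x ] x ∈ arrows (suc m) × pt x ≡ corner r
  corner-arrow refl r≼ with corner-window r≼
  ... | t≤a , a<h , h≤n =
    (vertex t≤n , vertex h≤n) ,
    ∈-arrows (<⇒≢ t<h ∘ λ t≡h → trans (sym (toℕ-vertex t≤n)) (trans (cong toℕ t≡h) (toℕ-vertex h≤n))) ,
    cong₂ _,_ (toℕ-vertex t≤n) (toℕ-vertex h≤n)
    where
      t≤n = ≤-trans t≤a (≤-trans (m≤m+n a b) (n≤1+n _))
      t<h = ≤-<-trans t≤a a<h

-- Staircases

module Staircases (R : RuleSet) (thth : choice R THTH ≡ nest) where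

  private
    v : Valid TTHH (choice R TTHH)
    v = valid R TTHH

  on-staircase? : ∀ {m} a b p (x : Arrow (suc m)) → Dec (pt x ∈ map (Grid.corner v a b) (points (0 , 0) p))
  on-staircase? a b p x = pt x ∈ℕ²? map (Grid.corner v a b) (points (0 , 0) p)

  staircase : ∀ m → ℕ → ℕ → List Step → List (Arrow (suc m))
  staircase m a b p = filter (on-staircase? a b p) (arrows (suc m))

  record ForwardSaturated (m : ℕ) (σ : List (Arrow (suc m))) : Set where
    field
      face        : σ ∈ faces R (suc m)
      saturated   : T (saturatedᵇ (suc m) σ)
      no-backward : #backward σ ≡ 0

  record IsStaircase (m : ℕ) (σ : List (Arrow (suc m))) : Set where
    field
      {a b}      : ℕ
      a+b≡m      : a + b ≡ m
      path       : List Step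
      ends       : endpoint (0 , 0) path ≡ (a , b)
      staircase≡ : staircase m a b path ≡ σ

  module StaircaseOfPath {m a b} (a+b≡m : a + b ≡ m) {p} (ends : endpoint (0 , 0) p ≡ (a , b)) where

    open Grid v a b

    σ : List (Arrow (suc m))
    σ = staircase m a b p

    on-grid : ∀ {r} → r ∈ points (0 , 0) p → r ≼ (a , b)
    on-grid r∈ = subst (_ ≼_) ends (points-≼ (0 , 0) p r∈)

    OnPath : Arrow (suc m) → Set
    OnPath x = ∃[ r ] r ∈ points (0 , 0) p × pt x ≡ corner r

    on-path⇔ : ∀ {x} → pt x ∈ map corner (points (0 , 0) p) ⇔ OnPath x
    on-path⇔ = mk⇔ (λ x∈ → let (r , r∈ , e) = ∈-map⁻ corner x∈ in r , r∈ , e)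
                   (λ (r , r∈ , e) → subst (_∈ _) (sym e) (∈-map⁺ corner r∈))

    ∈σ⇔ : ∀ {x} → x ∈ σ ⇔ OnPath x
    ∈σ⇔ {x} = mk⇔ (Equivalence.to on-path⇔ ∘ proj₂ ∘ ∈-filter⁻ (on-staircase? a b p) {xs = arrows (suc m)}) from
      where
        from : OnPath x → x ∈ σ
        from (r , r∈ , e) with corner-arrow a+b≡m (on-grid r∈)
        ... | x′ , x′∈ , e′ = ∈-filter⁺ (on-staircase? a b p) (subst (_∈ _) (pt-injective (trans e′ (sym e))) x′∈)
                                        (Equivalence.from on-path⇔ (r , r∈ , e))

    arrow-at : ∀ {r} → r ∈ points (0 , 0) p → ∃[ x ] x ∈ σ × pt x ≡ corner r
    arrow-at r∈ with corner-arrow a+b≡m (on-grid r∈)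
    ... | x , _ , e = x , Equivalence.from ∈σ⇔ (_ , r∈ , e) , e

    window : ∀ {x} → OnPath x → toℕ (tail x) ≤ a × a < toℕ (head x)
    window (r , r∈ , e) with corner-window (on-grid r∈)
    ... | t≤a , a<h , _ = subst (_≤ a) (sym (cong proj₁ e)) t≤a , subst (a <_) (sym (cong proj₂ e)) a<h

    forward : ∀ {x} → OnPath x → toℕ (tail x) < toℕ (head x)
    forward x↑ = let (t≤a , a<h) = window x↑ in ≤-<-trans t≤a a<h

    endX≡a : endX p ≡ a
    endX≡a = cong proj₁ (trans (sym (endpoint-origin p)) ends)

    endY≡b : endY p ≡ b
    endY≡b = cong proj₂ (trans (sym (endpoint-origin p)) ends)

    tail⇔ : ∀ w → Tail σ w ⇔ toℕ w ≤ a
    tail⇔ w = mk⇔ (λ { (x , x∈ , refl) → proj₁ (window (Equivalence.to ∈σ⇔ x∈)) }) from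
      where
        from : toℕ w ≤ a → Tail σ w
        from w≤a with points-cover₁ p (subst (toℕ w ≤_) (sym endX≡a) w≤a)
        ... | r , r∈ , r₁≡w with arrow-at r∈
        ...   | x , x∈ , e = x , x∈ , toℕ-injective (trans (cong proj₁ e) r₁≡w)

    head⇔ : ∀ w → Head σ w ⇔ a < toℕ w
    head⇔ w = mk⇔ (λ { (x , x∈ , refl) → proj₂ (window (Equivalence.to ∈σ⇔ x∈)) }) from
      where
        w≤n : toℕ w ≤ suc (a + b)
        w≤n = subst (λ k → toℕ w ≤ suc k) (sym a+b≡m) (toℕ≤pred[n] w)
        from : a < toℕ w → Head σ w
        from a<w with points-cover₂ p (subst (_ ≤_) (sym endY≡b) (proj₂ (uncorner-≼ {0} z≤n w≤n)))
        ... | (i , j) , r∈ , refl with arrow-at r∈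
        ...   | x , x∈ , e = x , x∈ , toℕ-injective (trans (cong proj₂ e) (cong proj₂ (corner-uncorner {0} a<w w≤n)))

    saturated : T (saturatedᵇ (suc m) σ)
    saturated = Equivalence.from (saturated⇔ σ) covered
      where
        covered : ∀ w → Covered σ w
        covered w with toℕ w ≤? a
        ... | yes w≤a = let (x , x∈ , e) = Equivalence.from (tail⇔ w) w≤a in x , x∈ , inj₁ e
        ... | no  w≰a = let (x , x∈ , e) = Equivalence.from (head⇔ w) (≰⇒> w≰a) in x , x∈ , inj₂ e

    no-backward : #backward σ ≡ 0
    no-backward = cong length (filter-none (T? ∘ backwardᵇ) (All.tabulate λ x∈ →
                    <⇒≱ (forward (Equivalence.to ∈σ⇔ x∈)) ∘ <⇒≤ ∘ <ᵇ⇒< _ _))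

    #forward≡ : #forward σ ≡ suc (length p)
    #forward≡ = begin
      #forward σ
        ≡⟨ cong length (filter-all (T? ∘ forwardᵇ) (All.tabulate (<⇒<ᵇ ∘ forward ∘ Equivalence.to ∈σ⇔))) ⟩
      length σ
        ≡⟨ length-filter-bijection (on-staircase? a b p) pt arrows-Unique corners! (λ _ → id)
                                   (λ _ _ _ _ → pt-injective) onto ⟩
      length (map corner (points (0 , 0) p))
        ≡⟨ length-map corner (points (0 , 0) p) ⟩
      length (points (0 , 0) p)
        ≡⟨ length-points (0 , 0) p ⟩
      suc (length p)
        ∎
      where
        open ≡-Reasoning
        corners! : Unique (map corner (points (0 , 0) p))
        corners! = Unique-map⁺ (λ r∈ r′∈ → corner-injective (on-grid r∈) (on-grid r′∈)) (points-Unique (0 , 0) p)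
        onto : ∀ {q} → q ∈ map corner (points (0 , 0) p) →
               ∃[ x ] x ∈ arrows (suc m) × pt x ∈ map corner (points (0 , 0) p) × pt x ≡ q
        onto q∈ with ∈-map⁻ corner q∈
        ... | r , r∈ , refl with corner-arrow a+b≡m (on-grid r∈)
        ...   | x , x∈ , e = x , x∈ , subst (_∈ _) (sym e) q∈ , e

    #tails≡ : #tails σ ≡ suc a
    #tails≡ = #tails-initial σ (≤-trans (m≤m+n a b) (≤-trans (≤-reflexive a+b≡m) (n≤1+n m))) tail⇔

    #heads≡ : #heads σ ≡ suc b
    #heads≡ = #heads-final σ (cong suc a+b≡m) head⇔

    heads-ordered : ∀ {x y} → OnPath x → OnPath y → toℕ (tail x) < toℕ (tail y) →
                    HeadOrder v (toℕ (head x)) (toℕ (head y))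
    heads-ordered ((i , j) , r∈ , ex) ((i′ , j′) , r′∈ , ey) t<t′ with points-chain (0 , 0) p r∈ r′∈
    ... | inj₁ (_ , j≤j′) =
      subst₂ (HeadOrder v) (sym (cong proj₂ ex)) (sym (cong proj₂ ey))
             (Equivalence.from (HeadOrder-reflect v a (proj₂ (on-grid r∈)) (proj₂ (on-grid r′∈))) j≤j′)
    ... | inj₂ (i′≤i , _) = ⊥-elim (<⇒≱ (subst₂ _<_ (cong proj₁ ex) (cong proj₁ ey) t<t′) i′≤i)

    face : σ ∈ faces R (suc m)
    face = ∈-filter⁺ (T? ∘ isFaceᵇ R) (filter-∈-sublists (on-staircase? a b p) (arrows (suc m)))
                     (Equivalence.from (isFaceᵇ⇔ R σ) (AllPairs-filter⁺ (on-staircase? a b p) edge arrows-sorted))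
      where
        edge : ∀ {x y} → pt x ∈ map corner (points (0 , 0) p) → pt y ∈ map corner (points (0 , 0) p) →
               pt x <ₗ pt y → T (edgeᵇ R x y)
        edge x∈ y∈ (inj₁ t<t′) =
          let x↑ = Equivalence.to on-path⇔ x∈; y↑ = Equivalence.to on-path⇔ y∈ in
          Equivalence.from (edge-forward R thth (forward x↑) (forward y↑) t<t′)
            (≤-<-trans (proj₁ (window y↑)) (proj₂ (window x↑)) , heads-ordered x↑ y↑ t<t′)
        edge _ _ (inj₂ (t≡t′ , h<h′)) = edge-common-tail R (toℕ-injective t≡t′) (<⇒≢ h<h′ ∘ cong toℕ)

  module StaircaseOfFace {m} {σ : List (Arrow (suc m))} (F : ForwardSaturated m σ) where

    open ForwardSaturated F

    σ-sublist : σ ∈ sublists (arrows (suc m))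
    σ-sublist = proj₁ (∈-filter⁻ (T? ∘ isFaceᵇ R) face)

    ordered-edge : ∀ {x y} → x ∈ σ → y ∈ σ → pt x <ₗ pt y → T (edgeᵇ R x y)
    ordered-edge x∈ y∈ x<y with AllPairs-∈ (AllPairs.zip (sorted , edges)) x∈ y∈
      where
        sorted = sublists-AllPairs (arrows (suc m)) σ-sublist arrows-sorted
        edges  = Equivalence.to (isFaceᵇ⇔ R σ)
                   (proj₂ (∈-filter⁻ (T? ∘ isFaceᵇ R) {xs = sublists (arrows (suc m))} face))
    ... | inj₁ refl             = ⊥-elim (<ₗ-asym x<y x<y)
    ... | inj₂ (inj₁ (_ , e))   = e
    ... | inj₂ (inj₂ (y<x , _)) = ⊥-elim (<ₗ-asym x<y y<x)

    forward : ∀ {x} → x ∈ σ → toℕ (tail x) < toℕ (head x)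
    forward {x} x∈ with toℕ (head x) <? toℕ (tail x)
    ... | yes h<t = ⊥-elim (<-irrefl (sym no-backward) (∈-length (∈-filter⁺ (T? ∘ backwardᵇ) x∈ (<⇒<ᵇ h<t))))
    ... | no  h≮t = ≤∧≢⇒< (≮⇒≥ h≮t) (arrows-loopless (sublists-⊆ (arrows (suc m)) σ-sublist x∈) ∘ toℕ-injective)

    tails-before-heads : ∀ {x y} → x ∈ σ → y ∈ σ → toℕ (tail x) < toℕ (head y)
    tails-before-heads {x} {y} x∈ y∈ with <-cmp (toℕ (tail x)) (toℕ (tail y))
    ... | tri< tx<ty _ _ = <-trans tx<ty (forward y∈)
    ... | tri≈ _ tx≡ty _ = subst (_< _) (sym tx≡ty) (forward y∈)
    ... | tri> _ _ ty<tx =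
      proj₁ (Equivalence.to (edge-forward R thth (forward y∈) (forward x∈) ty<tx) (ordered-edge y∈ x∈ (inj₁ ty<tx)))

    heads-ordered : ∀ {x y} → x ∈ σ → y ∈ σ → toℕ (tail x) < toℕ (tail y) → HeadOrder v (toℕ (head x)) (toℕ (head y))
    heads-ordered x∈ y∈ tx<ty =
      proj₂ (Equivalence.to (edge-forward R thth (forward x∈) (forward y∈) tx<ty) (ordered-edge x∈ y∈ (inj₁ tx<ty)))

    covered : ∀ w → Covered σ w
    covered = Equivalence.to (saturated⇔ σ) saturated

    last-tail : ∃[ x ] x ∈ σ × (∀ {y} → y ∈ σ → toℕ (tail y) ≤ toℕ (tail x))
    last-tail with covered Fin.zero
    ... | x₀ , x₀∈ , _ =
      argmax (toℕ ∘ tail) x₀ σ , [ (λ e → subst (_∈ σ) (sym e) x₀∈) , id ]′ (argmax-sel (toℕ ∘ tail) x₀ σ)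
      , All.lookup (f[xs]≤f[argmax] x₀ σ)

    -- a is the last tail of the face.  Taking its arrow xₐ as a parameter, instead of projecting it out of
    -- last-tail, keeps a and b from unfolding into that proof.
    module LastTail {xₐ} (xₐ∈ : xₐ ∈ σ) (tail≤a : ∀ {y} → y ∈ σ → toℕ (tail y) ≤ toℕ (tail xₐ)) where

      a : ℕ
      a = toℕ (tail xₐ)

      a<head : ∀ {y} → y ∈ σ → a < toℕ (head y)
      a<head = tails-before-heads xₐ∈

      b : ℕ
      b = m ∸ a

      a+b≡m : a + b ≡ m
      a+b≡m = m+[n∸m]≡n (≤-pred (≤-trans (a<head xₐ∈) (toℕ≤pred[n] _)))

      head≤ : ∀ {y} → y ∈ σ → toℕ (head y) ≤ suc (a + b)
      head≤ {y} _ = subst (λ k → toℕ (head y) ≤ suc k) (sym a+b≡m) (toℕ≤pred[n] (head y))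

      open Grid v a b

      InGrid : ℕ² → Set
      InGrid r = r ≼ (a , b) × corner r ∈ map pt σ

      in-grid? : Decidable InGrid
      in-grid? r = ((proj₁ r ≤? a) ×-dec (proj₂ r ≤? b)) ×-dec (corner r ∈ℕ²? map pt σ)

      arrow-of : ∀ {r} → InGrid r → ∃[ x ] x ∈ σ × pt x ≡ corner r
      arrow-of (_ , c∈) = let (x , x∈ , e) = ∈-map⁻ pt c∈ in x , x∈ , sym e

      grid-point : ∀ {x} → x ∈ σ → InGrid (uncorner (pt x)) × corner (uncorner (pt x)) ≡ pt x
      grid-point x∈ = (uncorner-≼ (tail≤a x∈) (head≤ x∈) , subst (_∈ _) (sym c≡) (∈-map⁺ pt x∈)) , c≡
        where c≡ = corner-uncorner (a<head x∈) (head≤ x∈)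

      ≼-by-tails : ∀ {r r′} → InGrid r → InGrid r′ → proj₁ r < proj₁ r′ → r ≼ r′
      ≼-by-tails {i , j} {i′ , j′} gr@(r≼ , _) gr′@(r′≼ , _) i<i′ with arrow-of gr | arrow-of gr′
      ... | x , x∈ , ex | y , y∈ , ey =
        <⇒≤ i<i′ , Equivalence.to (HeadOrder-reflect v a (proj₂ r≼) (proj₂ r′≼))
                     (subst₂ (HeadOrder v) (cong proj₂ ex) (cong proj₂ ey)
                       (heads-ordered x∈ y∈ (subst₂ _<_ (sym (cong proj₁ ex)) (sym (cong proj₁ ey)) i<i′)))

      chain : ∀ {r r′} → InGrid r → InGrid r′ → r ≼ r′ ⊎ r′ ≼ r
      chain {i , j} {i′ , j′} gr gr′ with <-cmp i i′
      ... | tri< i<i′ _ _ = inj₁ (≼-by-tails gr gr′ i<i′)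
      ... | tri≈ _ refl _ = [ (λ j≤j′ → inj₁ (≤-refl , j≤j′)) , (λ j′≤j → inj₂ (≤-refl , j′≤j)) ]′ (≤-total j j′)
      ... | tri> _ _ i′<i = inj₂ (≼-by-tails gr′ gr i′<i)

      ≤a⇒≤n : ∀ {i} → i ≤ a → i ≤ suc m
      ≤a⇒≤n i≤a = ≤-trans i≤a (≤-trans (m≤m+n a b) (≤-trans (≤-reflexive a+b≡m) (n≤1+n m)))

      cover₁ : ∀ {i} → i ≤ a → ∃[ j ] InGrid (i , j)
      cover₁ {i} i≤a with covered (vertex (≤a⇒≤n i≤a))
      ... | x , x∈ , inj₁ tx≡w =
        reflect v b (toℕ (head x) ∸ suc a) ,
        subst (λ k → InGrid (k , reflect v b (toℕ (head x) ∸ suc a))) (trans (cong toℕ tx≡w) (toℕ-vertex (≤a⇒≤n i≤a)))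
              (proj₁ (grid-point x∈))
      ... | x , x∈ , inj₂ hx≡w =
        ⊥-elim (<⇒≱ (a<head x∈) (subst (_≤ a) (sym (trans (cong toℕ hx≡w) (toℕ-vertex (≤a⇒≤n i≤a)))) i≤a))

      head-≤ : ∀ {j} → j ≤ b → suc (a + reflect v b j) ≤ suc m
      head-≤ {j} j≤b = subst (λ k → suc (a + reflect v b j) ≤ suc k) a+b≡m (s≤s (+-monoʳ-≤ a (reflect-≤ v j≤b)))

      cover₂ : ∀ {j} → j ≤ b → ∃[ i ] InGrid (i , j)
      cover₂ {j} j≤b with covered (vertex (head-≤ j≤b))
      ... | x , x∈ , inj₁ tx≡w =
        ⊥-elim (<⇒≱ (s≤s (m≤m+n a _)) (subst (_≤ a) (trans (cong toℕ tx≡w) (toℕ-vertex (head-≤ j≤b))) (tail≤a x∈)))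
      ... | x , x∈ , inj₂ hx≡w =
        toℕ (tail x) , (tail≤a x∈ , j≤b) ,
        subst (_∈ map pt σ) (cong (toℕ (tail x) ,_) (trans (cong toℕ hx≡w) (toℕ-vertex (head-≤ j≤b)))) (∈-map⁺ pt x∈)

      open ChainToPath InGrid in-grid? a b proj₁ chain cover₁ cover₂ using (chain-path)

      is-staircase : IsStaircase m σ
      is-staircase = staircase-of chain-path
        where
          staircase-of : (∃[ p ] endpoint (0 , 0) p ≡ (a , b) × (∀ {r} → r ∈ points (0 , 0) p ⇔ InGrid r)) →
                         IsStaircase m σ
          staircase-of (p , ends , points⇔) =
            record { a+b≡m = a+b≡m ; path = p ; ends = ends ; staircase≡ = staircase≡ }
            where
              to : ∀ {x} → pt x ∈ map corner (points (0 , 0) p) → x ∈ σ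
              to x∈ with ∈-map⁻ corner x∈
              ... | r , r∈ , e with arrow-of (Equivalence.to points⇔ r∈)
              ...   | y , y∈ , e′ = subst (_∈ σ) (pt-injective (trans e′ (sym e))) y∈
              from : ∀ {x} → x ∈ σ → pt x ∈ map corner (points (0 , 0) p)
              from x∈ = let (g , c≡) = grid-point x∈ in subst (_∈ _) c≡ (∈-map⁺ corner (Equivalence.from points⇔ g))
              staircase≡ : staircase m a b p ≡ σ
              staircase≡ =
                filter-≡-sublist (on-staircase? a b p) (arrows (suc m)) arrows-Unique σ-sublist (λ _ → mk⇔ to from)

  forward-saturated⇒staircase : ∀ {m σ} → ForwardSaturated m σ → IsStaircase m σ
  forward-saturated⇒staircase F with StaircaseOfFace.last-tail F
  ... | _ , xₐ∈ , tail≤a = StaircaseOfFace.LastTail.is-staircase F xₐ∈ tail≤a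

  module Statistics {m σ} (S : IsStaircase m σ) where
    open IsStaircase S
    open StaircaseOfPath a+b≡m {path} ends using (#forward≡; #tails≡; #heads≡)

    #forward-staircase : #forward σ ≡ suc (length path)
    #forward-staircase = subst (λ τ → #forward τ ≡ suc (length path)) staircase≡ #forward≡

    #tails-staircase : #tails σ ≡ suc a
    #tails-staircase = subst (λ τ → #tails τ ≡ suc a) staircase≡ #tails≡

    #heads-staircase : #heads σ ≡ suc b
    #heads-staircase = subst (λ τ → #heads τ ≡ suc b) staircase≡ #heads≡

  staircase-injective : ∀ {m a b} → a + b ≡ m → ∀ {p p′} →
                        endpoint (0 , 0) p ≡ (a , b) → endpoint (0 , 0) p′ ≡ (a , b) →
                        staircase m a b p ≡ staircase m a b p′ → p ≡ p′
  staircase-injective {m} {a} {b} a+b≡m {p} {p′} ends ends′ same =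
    points-injective (0 , 0) p p′ (⊆ ends ends′ same) (⊆ ends′ ends (sym same))
    where
      open Grid v a b using (corner-injective)
      ⊆ : ∀ {p p′} (ends : endpoint (0 , 0) p ≡ (a , b)) (ends′ : endpoint (0 , 0) p′ ≡ (a , b)) →
          staircase m a b p ≡ staircase m a b p′ → ∀ {r} → r ∈ points (0 , 0) p → r ∈ points (0 , 0) p′
      ⊆ {p} {p′} ends ends′ same r∈ with StaircaseOfPath.arrow-at a+b≡m {p} ends r∈
      ... | x , x∈ , e with Equivalence.to (StaircaseOfPath.∈σ⇔ a+b≡m {p′} ends′) (subst (x ∈_) same x∈)
      ...   | r′ , r′∈ , e′ =
        subst (_∈ _) (sym (corner-injective (StaircaseOfPath.on-grid a+b≡m {p} ends r∈)
                                            (StaircaseOfPath.on-grid a+b≡m {p′} ends′ r′∈) (trans (sym e) e′))) r′∈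

  faces-Unique : ∀ n → Unique (faces R n)
  faces-Unique n = Unique.filter⁺ (T? ∘ isFaceᵇ R) (sublists-Unique (arrows n) arrows-Unique)

  module Counting {m : ℕ} where

    inFabᵇ : (a b k : ℕ) → List (Arrow (suc m)) → Bool
    inFabᵇ a b k σ =
      saturatedᵇ (suc m) σ ∧ (#backward σ ≡ᵇ 0) ∧ (#forward σ ≡ᵇ k) ∧ (#tails σ ≡ᵇ suc a) ∧ (#heads σ ≡ᵇ suc b)

    InFab : (a b k : ℕ) → List (Arrow (suc m)) → Set
    InFab a b k σ = T (saturatedᵇ (suc m) σ) × #backward σ ≡ 0 × #forward σ ≡ k × #tails σ ≡ suc a × #heads σ ≡ suc b

    T-inFab⇔ : ∀ {a b k} σ → T (inFabᵇ a b k σ) ⇔ InFab a b k σ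
    T-inFab⇔ _ = ⇔-trans T-∧ (⇔-refl ×-⇔ ⇔-trans T-∧ (T-≡ᵇ ×-⇔ ⇔-trans T-∧ (T-≡ᵇ ×-⇔ ⇔-trans T-∧ (T-≡ᵇ ×-⇔ T-≡ᵇ))))

    inFᵇ : ℕ → List (Arrow (suc m)) → Bool
    inFᵇ k σ = saturatedᵇ (suc m) σ ∧ (#backward σ ≡ᵇ 0) ∧ (#forward σ ≡ᵇ k)

    InF : ℕ → List (Arrow (suc m)) → Set
    InF k σ = T (saturatedᵇ (suc m) σ) × #backward σ ≡ 0 × #forward σ ≡ k

    T-inF⇔ : ∀ {k} σ → T (inFᵇ k σ) ⇔ InF k σ
    T-inF⇔ _ = ⇔-trans T-∧ (⇔-refl ×-⇔ ⇔-trans T-∧ (T-≡ᵇ ×-⇔ T-≡ᵇ))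

    InF⇒staircase : ∀ {k σ} → σ ∈ faces R (suc m) → InF k σ → IsStaircase m σ
    InF⇒staircase σ∈ (sat , back , _) =
      forward-saturated⇒staircase (record { face = σ∈ ; saturated = sat ; no-backward = back })

    module Pinned {a b k σ} (S : IsStaircase m σ) (counts : InFab a b k σ) where
      open IsStaircase S using (path)
      open Statistics S

      a-pinned : IsStaircase.a S ≡ a
      a-pinned = suc-injective (trans (sym #tails-staircase) (proj₁ (proj₂ (proj₂ (proj₂ counts)))))

      b-pinned : IsStaircase.b S ≡ b
      b-pinned = suc-injective (trans (sym #heads-staircase) (proj₂ (proj₂ (proj₂ (proj₂ counts)))))

      k-pinned : suc (length path) ≡ k
      k-pinned = trans (sym #forward-staircase) (proj₁ (proj₂ (proj₂ counts)))

    coeffFab≡0 : ∀ {a b k} → (∀ {σ} → IsStaircase m σ → InFab a b k σ → ⊥) → coeffFab R (suc m) a b k ≡ 0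
    coeffFab≡0 impossible =
      cong length (filter-none (T? ∘ inFabᵇ _ _ _) (All.tabulate λ {σ} σ∈ inFab →
        let counts = Equivalence.to (T-inFab⇔ σ) inFab
        in impossible (InF⇒staircase σ∈ (map₂ (map₂ proj₁) counts)) counts))

    coeffFab-no-arrows : ∀ {a b} → coeffFab R (suc m) a b 0 ≡ 0
    coeffFab-no-arrows = coeffFab≡0 (λ S counts → 0≢1+n (sym (Pinned.k-pinned S counts)))

    coeffFab-off-diagonal : ∀ {a b k} → a + b ≢ m → coeffFab R (suc m) a b k ≡ 0
    coeffFab-off-diagonal a+b≢m = coeffFab≡0 λ S counts →
      a+b≢m (subst₂ (λ a b → a + b ≡ m) (Pinned.a-pinned S counts) (Pinned.b-pinned S counts) (IsStaircase.a+b≡m S))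

    coeffFab-diagonal : ∀ {a b} → a + b ≡ m → ∀ k → coeffFab R (suc m) a b (suc k) ≡ coeffD a b k
    coeffFab-diagonal {a} {b} a+b≡m k =
      sym (length-filter-bijection (T? ∘ ends-at) (staircase m a b) (stepLists-Unique k)
                                   (Unique.filter⁺ (T? ∘ inFabᵇ a b (suc k)) (faces-Unique _)) into injective onto)
      where
        ends-at : List Step → Bool
        ends-at p = (endX p ≡ᵇ a) ∧ (endY p ≡ᵇ b)
        ends⇔ : ∀ p → T (ends-at p) ⇔ endpoint (0 , 0) p ≡ (a , b)
        ends⇔ p = ⇔-trans T-∧ (⇔-trans (T-≡ᵇ ×-⇔ T-≡ᵇ)
                    (mk⇔ (trans (endpoint-origin p) ∘ ×-≡,≡→≡) (×-≡,≡←≡ ∘ trans (sym (endpoint-origin p)))))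
        into : ∀ {p} → p ∈ stepLists k → T (ends-at p) →
               staircase m a b p ∈ filterᵇ (inFabᵇ a b (suc k)) (faces R (suc m))
        into {p} p∈ e =
          ∈-filter⁺ (T? ∘ inFabᵇ a b (suc k)) face
            (Equivalence.from (T-inFab⇔ (staircase m a b p))
              (saturated , no-backward , trans #forward≡ (cong suc (stepLists-length k p∈)) , #tails≡ , #heads≡))
          where open StaircaseOfPath a+b≡m {p} (Equivalence.to (ends⇔ p) e)
        injective : ∀ {p p′} → p ∈ stepLists k → p′ ∈ stepLists k → T (ends-at p) → T (ends-at p′) →
                    staircase m a b p ≡ staircase m a b p′ → p ≡ p′
        injective {p} {p′} _ _ e e′ =
          staircase-injective a+b≡m (Equivalence.to (ends⇔ p) e) (Equivalence.to (ends⇔ p′) e′)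
        path-of : ∀ {σ} → IsStaircase m σ → InFab a b (suc k) σ →
                  ∃[ p ] p ∈ stepLists k × T (ends-at p) × staircase m a b p ≡ σ
        path-of S counts =
          path , subst (λ l → path ∈ stepLists l) (suc-injective k-pinned) (∈-stepLists path)
               , Equivalence.from (ends⇔ path)
                   (subst₂ (λ a′ b′ → endpoint (0 , 0) path ≡ (a′ , b′)) a-pinned b-pinned ends)
               , subst₂ (λ a′ b′ → staircase m a′ b′ path ≡ _) a-pinned b-pinned staircase≡
          where
            open IsStaircase S using (path; ends; staircase≡)
            open Pinned S counts
        onto : ∀ {σ} → σ ∈ filterᵇ (inFabᵇ a b (suc k)) (faces R (suc m)) →
               ∃[ p ] p ∈ stepLists k × T (ends-at p) × staircase m a b p ≡ σ
        onto {σ} σ∈ =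
          let (σ∈faces , inFab) = ∈-filter⁻ (T? ∘ inFabᵇ a b (suc k)) {xs = faces R (suc m)} σ∈
              counts = Equivalence.to (T-inFab⇔ σ) inFab
          in path-of (InF⇒staircase σ∈faces (map₂ (map₂ proj₁) counts)) counts

    coeffFab≡coeffXD : ∀ {a b} → a + b ≡ m → ∀ k → coeffFab R (suc m) a b k ≡ coeffXD a b k
    coeffFab≡coeffXD a+b≡m zero    = coeffFab-no-arrows
    coeffFab≡coeffXD a+b≡m (suc k) = coeffFab-diagonal a+b≡m k

    unique-shape : ∀ {k σ} → IsStaircase m σ → InF k σ →
                   length (filterᵇ (λ a → inFabᵇ a (m ∸ a) k σ) (upTo (suc m))) ≡ 1
    unique-shape {k} {σ} S (sat , back , fwd) =
      length-filter-bijection (T? ∘ λ a → inFabᵇ a (m ∸ a) k σ) id (Unique.upTo⁺ (suc m)) ([] ∷ [])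
        (λ _ inFab → here (sym (Pinned.a-pinned S (Equivalence.to (T-inFab⇔ σ) inFab))))
        (λ _ _ _ _ → id)
        (λ { (here refl) → a , ∈-upTo⁺ (s≤s (subst (a ≤_) a+b≡m (m≤m+n a b))) ,
                             Equivalence.from (T-inFab⇔ σ) (sat , back , fwd , #tails-staircase , #heads-staircase′) ,
                             refl })
      where
        open IsStaircase S using (a; b; a+b≡m)
        open Statistics S
        #heads-staircase′ : #heads σ ≡ suc (m ∸ a)
        #heads-staircase′ = trans #heads-staircase (cong suc (trans (sym (m+n∸m≡n a b)) (cong (_∸ a) a+b≡m)))

    coeffF≡sum : ∀ k → coeffF R (suc m) k ≡ sum (map (λ a → coeffXD a (m ∸ a) k) (upTo (suc m)))
    coeffF≡sum k = begin
      coeffF R (suc m) k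
        ≡⟨ length-filter-partition (inFᵇ k) (λ a → inFabᵇ a (m ∸ a) k) (faces R (suc m)) (upTo (suc m)) once ⟩
      sum (map (λ a → coeffFab R (suc m) a (m ∸ a) k) (upTo (suc m)))
        ≡⟨ cong sum (map-cong-local (All.tabulate λ a∈ → coeffFab≡coeffXD (m+[n∸m]≡n (≤-pred (∈-upTo⁻ a∈))) k)) ⟩
      sum (map (λ a → coeffXD a (m ∸ a) k) (upTo (suc m)))
        ∎
      where
        open ≡-Reasoning
        once : ∀ {σ} → σ ∈ faces R (suc m) →
               length (filterᵇ (λ a → inFabᵇ a (m ∸ a) k σ) (upTo (suc m))) ≡ length (filterᵇ (inFᵇ k) [ σ ])
        once {σ} σ∈ with inFᵇ k σ in eq
        ... | false =
          cong length (filter-none (T? ∘ λ a → inFabᵇ a (m ∸ a) k σ) {xs = upTo (suc m)} (All.tabulate λ _ inFab →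
            subst T eq (Equivalence.from (T-inF⇔ σ) (map₂ (map₂ proj₁) (Equivalence.to (T-inFab⇔ σ) inFab)))))
        ... | true  = let counts = Equivalence.to (T-inF⇔ σ) (subst T (sym eq) _) in
                      unique-shape (InF⇒staircase σ∈ counts) counts

-- The only face of Δ₀ is the empty one, which has no tails.
coeffFab-zero : ∀ R a b k → coeffFab R 0 a b k ≡ 0
coeffFab-zero R a b zero    = refl
coeffFab-zero R a b (suc k) = refl

proposition6p12 : (R : RuleSet) → choice R THTH ≡ nest
    → (∀ m → IsTriangulationOfBoundary R (suc m))
    → ( coeffF R 0 0 ≡ 1
      × (∀ k → coeffF R 0 (suc k) ≡ 0)
      × (∀ m k → coeffF R (suc m) k ≡ sum (map (λ a → coeffXD a (m ∸ a) k) (upTo (suc m)))) )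
    × (∀ n a b k → (n ≡ suc (a + b) → coeffFab R n a b k ≡ coeffXD a b k)
                 × (n ≢ suc (a + b) → coeffFab R n a b k ≡ 0))
proposition6p12 R thth _ = (refl , (λ _ → refl) , λ m → coeffF≡sum {m}) , by-shape
  where
    open Staircases R thth
    open Counting
    by-shape : ∀ n a b k → (n ≡ suc (a + b) → coeffFab R n a b k ≡ coeffXD a b k)
                         × (n ≢ suc (a + b) → coeffFab R n a b k ≡ 0)
    by-shape n a b k = (λ { refl → coeffFab≡coeffXD refl k }) , off-diagonal n
      where
        off-diagonal : ∀ n → n ≢ suc (a + b) → coeffFab R n a b k ≡ 0
        off-diagonal zero    _   = coeffFab-zero R a b k
        off-diagonal (suc m) n≢ = coeffFab-off-diagonal (n≢ ∘ cong suc ∘ sym)
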